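{- Let $n\ge4$ and let $w$ be a $cd$-monomial of degree $n-1$ in which $d$ occurs $m$ times. Then there are at least $2^m$ André permutations $\pi$ of $[n]$ with $W(\pi)=wc$ and $\pi(n)=n$. Consequently, $[wc]\check\Phi^n_0\ge2^m$.
   Context: A permutation of a totally ordered finite set $X$ with $|X|=n$ is a bijection $\pi:[n]\to X$. A descent is $1\le i\le n-1$ with $\pi(i)>\pi(i+1)$; a double descent is an $i$ such that $i$ and $i+1$ are both descents. $\pi$ is an André permutation if (1) $\pi$ has no double descent, and (2) for every pair $2\le j<j'\le n-1$ with $\pi(j-1)=\max\{\pi(j-1),\pi(j),\pi(j'-1),\pi(j')\}$ and $\pi(j')=\min\{\pi(j-1),\pi(j),\pi(j'-1),\pi(j')\}$ there is $j<j''<j'$ with $\pi(j'')<\pi(j')$. The $cd$-type $W(\pi)$ (a $cd$-monomial of degree $n$, with $\deg c=1,\deg d=2$) is defined recursively: $W$ of the empty permutation is $1$; for $n=1$, $W(\pi)=c$; for $n\ge2$, $W(\pi)=W(\pi|_{[n-2]})d$ if $n-1$ is a descent and $W(\pi)=W(\pi|_{[n-1]})c$ otherwise. $[w]F$ denotes the coefficient of $w$ in $F$. The polynomials $\check\Phi^n_i$: let $\Lambda^n$ be the boundary complex of an $n$-simplex with facets $\sigma_0,\dots,\sigma_n$; for $0\le i\le n-1$ let $\Gamma^n_i$ be the complex generated by $\sigma_0,\dots,\sigma_i$ and $\Lambda^n_i$ the regular CW complex obtained by attaching a new $(n-1)$-cell $\tau$ with $\partial\tau=\partial\Gamma^n_i$.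 Its face poset with $\hat0,\hat1$ adjoined is Eulerian of rank $n+1$; let $\Phi_{\Lambda^n_i}$ be its $cd$-index (the polynomial in non-commuting $c,d$ with $\Phi(a+b,ab+ba)=\sum_{S\subseteq[n]}h_Su_S$, where $h_S=\sum_{T\subseteq S}(-1)^{|S\setminus T|}f_T$, $f_T$ counts chains $\hat0<x_1<\dots<\hat1$ with rank set $T$, and $u_S=u_1\cdots u_n$ with $u_i=b$ iff $i\in S$, else $a$). Set $\check\Phi^n_0=\Phi_{\Lambda^n_0}$ and $\check\Phi^n_i=\Phi_{\Lambda^n_i}-\Phi_{\Lambda^n_{i-1}}$ for $1\le i\le n-1$. -}

module Defs where

open import Data.Nat using (ℕ; zero; suc; _+_; _∸_; _<_; _≤_; _⊔_; _⊓_; _<ᵇ_; _≡ᵇ_)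
open import Data.Bool using (Bool; true; false; if_then_else_; not; _∧_; _∨_)
open import Data.List using (List; []; _∷_; _++_; map; length; upTo)
open import Data.Vec using (Vec; []; _∷_)
open import Data.Integer using (ℤ; +_; _*_; -1ℤ; 0ℤ) renaming (_+_ to _+ℤ_; _^_ to _^ℤ_)
open import Data.Product using (_×_; ∃-syntax)
open import Relation.Nullary using (¬_)
open import Relation.Binary.PropositionalEquality using (_≡_)
open import Data.List.Relation.Binary.Permutation.Propositional using (_↭_)

-- Permutations as lists  [π(1), …, π(n)]

-- 1-indexed lookup; positions outside 1..length give 0 (never used).
at : List ℕ → ℕ → ℕ
at [] i = 0
at (x ∷ xs) zero = 0
at (x ∷ xs) (suc zero) = x
at (x ∷ xs) (suc (suc i)) = at xs (suc i)

IsPermutationOf : ℕ → List ℕ → Set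
IsPermutationOf n π = π ↭ map suc (upTo n)

Descent : List ℕ → ℕ → Set
Descent π i = (1 ≤ i) × (i ≤ length π ∸ 1) × (at π (suc i) < at π i)

NoDoubleDescent : List ℕ → Set
NoDoubleDescent π = ∀ i → ¬ (Descent π i × Descent π (suc i))

AndreCondition2 : List ℕ → Set
AndreCondition2 π =
  ∀ j j′ → 2 ≤ j → j < j′ → j′ ≤ length π ∸ 1 →
  let p = at π
      mx = p (j ∸ 1) ⊔ p j ⊔ p (j′ ∸ 1) ⊔ p j′
      mn = p (j ∸ 1) ⊓ p j ⊓ p (j′ ∸ 1) ⊓ p j′
  in p (j ∸ 1) ≡ mx → p j′ ≡ mn →
     ∃[ j″ ] (j < j″ × j″ < j′ × p j″ < p j′)

IsAndre : List ℕ → Set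
IsAndre π = NoDoubleDescent π × AndreCondition2 π

data CD : Set where
  c d : CD

degCD : List CD → ℕ
degCD [] = 0
degCD (c ∷ w) = suc (degCD w)
degCD (d ∷ w) = suc (suc (degCD w))

countD : List CD → ℕ
countD [] = 0
countD (c ∷ w) = countD w
countD (d ∷ w) = suc (countD w)

-- W' π k = W(π restricted to positions [k])
W′ : List ℕ → ℕ → List CD
W′ π zero = []
W′ π (suc zero) = c ∷ []
W′ π (suc (suc k)) =
  if at π (suc (suc k)) <ᵇ at π (suc k)
  then W′ π k ++ (d ∷ [])
  else W′ π (suc k) ++ (c ∷ [])

W : List ℕ → List CD
W π = W′ π (length π)

filterᵇ : {A : Set} → (A → Bool) → List A → List A
filterᵇ p [] = []
filterᵇ p (x ∷ xs) = if p x then x ∷ filterᵇ p xs else filterᵇ p xs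

data AB : Set where
  a b : AB

sumℤ : List ℤ → ℤ
sumℤ [] = 0ℤ
sumℤ (x ∷ xs) = x +ℤ sumℤ xs

sumℕ : List ℕ → ℕ
sumℕ [] = 0
sumℕ (x ∷ xs) = x + sumℕ xs

cdWords : ℕ → List (List CD)
cdWords zero = [] ∷ []
cdWords (suc zero) = (c ∷ []) ∷ []
cdWords (suc (suc k)) = map (c ∷_) (cdWords (suc k)) ++ map (d ∷_) (cdWords k)

-- coefficient of the ab-word u in v(a+b, ab+ba)
expandCoeff : List CD → List AB → ℕ
expandCoeff [] [] = 1
expandCoeff (c ∷ v) (x ∷ u) = expandCoeff v u
expandCoeff (d ∷ v) (a ∷ b ∷ u) = expandCoeff v u
expandCoeff (d ∷ v) (b ∷ a ∷ u) = expandCoeff v u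
expandCoeff _ _ = 0

-- coefficient of u in Φ(a+b, ab+ba), for Φ homogeneous of degree |u|
substCoeff : (List CD → ℤ) → List AB → ℤ
substCoeff Φ u = sumℤ (map (λ v → Φ v * + expandCoeff v u) (cdWords (length u)))

-- A finite graded poset with 0̂ (rank 0) and 1̂ (rank n+1), with decidable strict order
record FinGradedPoset : Set₁ where
  field
    Carrier : Set
    elems   : List Carrier      -- all elements, each exactly once
    rank    : Carrier → ℕ
    _<ᴾ_    : Carrier → Carrier → Bool
    bot     : Carrier

countChains : (P : FinGradedPoset) → FinGradedPoset.Carrier P → List ℕ → ℕ
countChains P prev [] = 1
countChains P prev (t ∷ ts) =
  sumℕ (map (λ x → countChains P x ts)
            (filterᵇ (λ x → (rank x ≡ᵇ t) ∧ (prev <ᴾ x)) elems))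
  where open FinGradedPoset P

-- positions (1-indexed, starting at offset+1) of the letters b
bPositions : ℕ → List AB → List ℕ
bPositions k [] = []
bPositions k (a ∷ u) = bPositions (suc k) u
bPositions k (b ∷ u) = suc k ∷ bPositions (suc k) u

countB : List AB → ℕ
countB u = length (bPositions 0 u)

-- ab-words v obtained from u by replacing some b's by a's (i.e. T ⊆ S)
subWords : List AB → List (List AB)
subWords [] = [] ∷ []
subWords (a ∷ u) = map (a ∷_) (subWords u)
subWords (b ∷ u) = map (a ∷_) (subWords u) ++ map (b ∷_) (subWords u)

-- flag f-vector f_T (T given by the word with b exactly at T)
flagF : FinGradedPoset → List AB → ℕ
flagF P v = countChains P (FinGradedPoset.bot P) (bPositions 0 v)

-- flag h-vector h_S = Σ_{T ⊆ S} (-1)^{|S∖T|} f_T ; this is the coefficient of u_S in the ab-index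
flagH : FinGradedPoset → List AB → ℤ
flagH P u = sumℤ (map (λ v → (-1ℤ ^ℤ (countB u ∸ countB v)) * + flagF P v) (subWords u))

IsCDIndex : ℕ → FinGradedPoset → (List CD → ℤ) → Set
IsCDIndex n P Φ =
  (∀ v → ¬ (degCD v ≡ n) → Φ v ≡ 0ℤ) ×
  (∀ u → length u ≡ n → substCoeff Φ u ≡ flagH P u)

-- READING: Λⁿ₀ = Γⁿ₀ ∪ τ, i.e. the new (n-1)-cell τ is attached to Γⁿ₀ (the closed facet σ₀)
-- along ∂τ = ∂σ₀ (this is what makes the face poset Eulerian).
-- Label the n vertices of σ₀ by Fin n; the faces of σ₀ are the nonempty vertex subsets,
-- a face with k vertices having rank k.  τ has rank n and lies above every proper face of σ₀.

Subset : ℕ → Set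
Subset k = Vec Bool k

allSubsets : (k : ℕ) → List (Subset k)
allSubsets zero = [] ∷ []
allSubsets (suc k) = map (false ∷_) (allSubsets k) ++ map (true ∷_) (allSubsets k)

size : ∀ {k} → Subset k → ℕ
size [] = 0
size (false ∷ s) = size s
size (true ∷ s) = suc (size s)

⊆ᵇ : ∀ {k} → Subset k → Subset k → Bool
⊆ᵇ [] [] = true
⊆ᵇ (x ∷ s) (y ∷ t) = (not x ∨ y) ∧ ⊆ᵇ s t

⊂ᵇ : ∀ {k} → Subset k → Subset k → Bool
⊂ᵇ s t = ⊆ᵇ s t ∧ (size s <ᵇ size t)

data FaceΛ (n : ℕ) : Set where
  bot  : FaceΛ n
  cell : Subset n → FaceΛ n   -- a nonempty face of σ₀ (vertex set)
  tau  : FaceΛ n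
  top  : FaceΛ n

isTop : ∀ {n} → FaceΛ n → Bool
isTop top = true
isTop _ = false

isBot : ∀ {n} → FaceΛ n → Bool
isBot bot = true
isBot _ = false

ltΛ : ∀ {n} → FaceΛ n → FaceΛ n → Bool
ltΛ bot y = not (isBot y)
ltΛ (cell s) (cell t) = ⊂ᵇ s t
ltΛ {n} (cell s) tau = size s <ᵇ n      -- s is a face of ∂σ₀ = ∂τ
ltΛ (cell s) top = true
ltΛ (cell s) bot = false
ltΛ tau y = isTop y
ltΛ top y = false

rankΛ : ∀ {n} → FaceΛ n → ℕ
rankΛ bot = 0
rankΛ (cell s) = size s
rankΛ {n} tau = n
rankΛ {n} top = suc n

Λ0 : ℕ → FinGradedPoset
Λ0 n = record
  { Carrier = FaceΛ n
  ; elems = bot ∷ (map cell (filterᵇ (λ s → 0 <ᵇ size s) (allSubsets n))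
                   ++ (tau ∷ top ∷ []))
  ; rank = rankΛ
  ; _<ᴾ_ = ltΛ
  ; bot = bot
  }

IsCheckPhi0 : ℕ → (List CD → ℤ) → Set
IsCheckPhi0 n Φ = IsCDIndex n (Λ0 n) Φ

{-# OPTIONS --safe #-}
-- Let σ be a permutation of [L] such that σ followed by L+1 is an André permutation of
-- cd-type v c.  Appending L+2 gives type v c c; appending L+2, L+1, L+3 to σ, or L+2, 1, L+3 to σ
-- shifted up by one, gives two distinct André permutations of type v d c.  So every d of w doubles the
-- number of permutations, except a leading one (type d c has only 213); this loss is made up by
-- listing the two permutations of type d c c and the four of type d d c by hand, which is where
-- w ≠ d, i.e. n ≥ 4, is used.
--
-- The face poset of Λⁿ₀ is B_n with its top element doubled, so its flag f-vector is
-- that of B_n, doubled on rank sets containing n.  Writing cd-monomials in the basis of flag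
-- f-numbers, the Ehrenborg–Readdy recursion Φ(B_{N+1}) = Φ(B_N) c + G(Φ(B_N)) is shown to produce
-- exactly the flag f-vectors of the Boolean algebras, hence Φ(Λⁿ₀) = Φ(B_n) c because the
-- ab-expansions of cd-monomials are linearly independent.  Thus [wc]Φ(Λⁿ₀) is the multiplicity of w in
-- the recursion, which is at least 2^m: w′c comes from w′, and w′d comes from two distinct monomials
-- of degree n − 2 with as many d's as w′, namely w′c and w′ with one d turned into c (G c = d and
-- G d = cd), or from c^{n−2} and c^{n−4}d when w′ has no d.
module Submission where

open import Defs
open import Data.Nat using (ℕ; zero; suc; _+_; _*_; _∸_; _^_; _≤_; _<_; z≤n; s≤s; _⊔_; _⊓_; _<ᵇ_; _≡ᵇ_; _≤?_; _<?_)
open import Data.Nat.Properties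
open import Data.Nat.Combinatorics using (_C_; nCn≡1; nCk+nC[k+1]≡[n+1]C[k+1])
open import Data.Bool using (Bool; true; false; if_then_else_; _∧_; T)
open import Data.Bool.Properties using (∧-identityʳ; ∧-zeroʳ)
open import Data.Unit using (⊤; tt)
open import Data.Vec using ([]; _∷_)
open import Data.List using (List; []; _∷_; _++_; map; length; upTo; reverse; replicate; concatMap; InitLast; initLast; _∷ʳ′_)
open import Data.List.Properties using (≡-dec; length-++; ++-assoc; ++-identityʳ; map-∘; map-++; length-map; map-injective; upTo-∷ʳ; map-applyUpTo; unfold-reverse; reverse-involutive; ∷ʳ-injective; ∷ʳ-injectiveˡ; ∷ʳ-injectiveʳ)
open import Data.List.Relation.Unary.All as All using (All; []; _∷_)
import Data.List.Relation.Unary.All.Properties as Allₚ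
open import Data.Product using (_×_; _,_; proj₁; proj₂; ∃-syntax)
open import Data.Sum using (_⊎_; inj₁; inj₂)
open import Data.Empty using (⊥; ⊥-elim)
open import Relation.Nullary using (Dec; ¬_; ¬?; yes; no; does)
open import Relation.Nullary.Decidable using (_×-dec_; _→-dec_; map′; True; toWitness; dec-true; dec-false)
open import Data.List.Relation.Binary.Permutation.Propositional using (_↭_; prep; swap; ↭-sym; ↭-trans; module PermutationReasoning) renaming (refl to ↭-refl)
open import Data.List.Relation.Binary.Permutation.Propositional.Properties using (All-resp-↭; ++⁺; ++⁺ˡ; ++⁺ʳ; shift; map⁺)
open import Data.List.Relation.Unary.Unique.Propositional using (Unique)
import Data.List.Relation.Unary.Unique.Propositional.Properties as Uniqueₚ
open import Data.List.Relation.Unary.AllPairs using ([]; _∷_)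
open import Data.List.Membership.Propositional using (_∈_)
open import Data.List.Membership.Propositional.Properties using (∈-map⁻)
import Data.Nat.Tactic.RingSolver as ℕ-Solver
open import Algebra.Properties.CommutativeSemigroup +-commutativeSemigroup using () renaming (interchange to +-interchange; x∙yz≈y∙xz to +-exchange)
open import Relation.Binary.Definitions using (tri<; tri≈; tri>; DecidableEquality)
open import Relation.Binary.PropositionalEquality

degCD-++ : ∀ u v → degCD (u ++ v) ≡ degCD u + degCD v
degCD-++ [] v = refl
degCD-++ (c ∷ u) v = cong suc (degCD-++ u v)
degCD-++ (d ∷ u) v = cong (2 +_) (degCD-++ u v)

countD-++ : ∀ u v → countD (u ++ v) ≡ countD u + countD v
countD-++ [] v = refl
countD-++ (c ∷ u) v = countD-++ u v
countD-++ (d ∷ u) v = cong suc (countD-++ u v)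

degCD-∷ʳ : ∀ u x → degCD (u ++ x ∷ []) ≡ degCD (x ∷ u)
degCD-∷ʳ u c = trans (degCD-++ u (c ∷ [])) (+-comm (degCD u) 1)
degCD-∷ʳ u d = trans (degCD-++ u (d ∷ [])) (+-comm (degCD u) 2)

countD-∷ʳ : ∀ u x → countD (u ++ x ∷ []) ≡ countD (x ∷ u)
countD-∷ʳ u c = trans (countD-++ u (c ∷ [])) (+-identityʳ (countD u))
countD-∷ʳ u d = trans (countD-++ u (d ∷ [])) (+-comm (countD u) 1)

degCD-d→c : ∀ p s → suc (degCD (p ++ c ∷ s)) ≡ degCD (p ++ d ∷ s)
degCD-d→c [] s = refl
degCD-d→c (c ∷ p) s = cong suc (degCD-d→c p s)
degCD-d→c (d ∷ p) s = cong (2 +_) (degCD-d→c p s)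

countD-d→c : ∀ p s → suc (countD (p ++ c ∷ s)) ≡ countD (p ++ d ∷ s)
countD-d→c [] s = refl
countD-d→c (c ∷ p) s = countD-d→c p s
countD-d→c (d ∷ p) s = cong suc (countD-d→c p s)

degCD-reverse : ∀ u → degCD (reverse u) ≡ degCD u
degCD-reverse [] = refl
degCD-reverse (x ∷ u) = trans (cong degCD (unfold-reverse x u)) (trans (degCD-∷ʳ (reverse u) x) (underCons x))
  where
  underCons : ∀ x → degCD (x ∷ reverse u) ≡ degCD (x ∷ u)
  underCons c = cong suc (degCD-reverse u)
  underCons d = cong (2 +_) (degCD-reverse u)

countD-reverse : ∀ u → countD (reverse u) ≡ countD u
countD-reverse [] = refl
countD-reverse (x ∷ u) = trans (cong countD (unfold-reverse x u)) (trans (countD-∷ʳ (reverse u) x) (underCons x))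
  where
  underCons : ∀ x → countD (x ∷ reverse u) ≡ countD (x ∷ u)
  underCons c = countD-reverse u
  underCons d = cong suc (countD-reverse u)

cdWords-degree : ∀ n → All (λ v → degCD v ≡ n) (cdWords n) × All (λ v → degCD v ≡ suc n) (cdWords (suc n))
cdWords-degree zero = refl ∷ [] , refl ∷ []
cdWords-degree (suc n) with cdWords-degree n
... | degₙ , degₙ₊₁ = degₙ₊₁ , Allₚ.++⁺ (Allₚ.gmap⁺ (cong suc) degₙ₊₁) (Allₚ.gmap⁺ (cong (2 +_)) degₙ)

at-++ˡ : ∀ xs ys i → 1 ≤ i → i ≤ length xs → at (xs ++ ys) i ≡ at xs i
at-++ˡ (x ∷ xs) ys (suc zero) _ _ = refl
at-++ˡ (x ∷ xs) ys (suc (suc i)) _ (s≤s le) = at-++ˡ xs ys (suc i) (s≤s z≤n) le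

at-++ʳ : ∀ xs ys i → at (xs ++ ys) (suc (i + length xs)) ≡ at ys (suc i)
at-++ʳ [] ys i = cong (λ k → at ys (suc k)) (+-identityʳ i)
at-++ʳ (x ∷ xs) ys i = trans (cong (λ k → at (x ∷ xs ++ ys) (suc k)) (+-suc i (length xs))) (at-++ʳ xs ys i)

at-∷ʳ : ∀ xs (x : ℕ) → at (xs ++ x ∷ []) (suc (length xs)) ≡ x
at-∷ʳ xs x = at-++ʳ xs (x ∷ []) 0

at-map : ∀ (f : ℕ → ℕ) xs i → 1 ≤ i → i ≤ length xs → at (map f xs) i ≡ f (at xs i)
at-map f (x ∷ xs) (suc zero) _ _ = refl
at-map f (x ∷ xs) (suc (suc i)) _ (s≤s le) = at-map f xs (suc i) (s≤s z≤n) le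

at-All : ∀ {P : ℕ → Set} xs i → All P xs → 1 ≤ i → i ≤ length xs → P (at xs i)
at-All (x ∷ xs) (suc zero) (p ∷ ps) _ _ = p
at-All (x ∷ xs) (suc (suc i)) (p ∷ ps) _ (s≤s le) = at-All xs (suc i) ps (s≤s z≤n) le

length-∷ʳ : ∀ (xs : List ℕ) x → length (xs ++ x ∷ []) ≡ suc (length xs)
length-∷ʳ xs x = trans (length-++ xs) (+-comm (length xs) 1)

<ᵇ-true : ∀ {m n} → m < n → (m <ᵇ n) ≡ true
<ᵇ-true {zero} {suc n} _ = refl
<ᵇ-true {suc m} {suc n} (s≤s p) = <ᵇ-true p

<ᵇ-false : ∀ {m n} → n ≤ m → (m <ᵇ n) ≡ false
<ᵇ-false {m} {zero} _ = refl
<ᵇ-false {suc m} {suc n} (s≤s p) = <ᵇ-false p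

descent? : ∀ π i → Dec (Descent π i)
descent? π i = (1 ≤? i) ×-dec (i ≤? length π ∸ 1) ×-dec (at π (suc i) <? at π i)

noDoubleDescent? : ∀ π → Dec (NoDoubleDescent π)
noDoubleDescent? π = map′ unbound bound (allUpTo? (λ i → ¬? (descent? π i ×-dec descent? π (suc i))) (length π))
  where
  Bounded : Set
  Bounded = ∀ {i} → i < length π → ¬ (Descent π i × Descent π (suc i))
  unbound : Bounded → NoDoubleDescent π
  unbound h i dd@(_ , (_ , le , _)) = h (≤-trans le (m∸n≤m (length π) 1)) dd
  bound : NoDoubleDescent π → Bounded
  bound nd _ = nd _

module _ (π : List ℕ) where
  private
    p : ℕ → ℕ
    p = at π

  AndrePair : ℕ → ℕ → Set
  AndrePair j j′ = 2 ≤ j → j′ ≤ length π ∸ 1 →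
    p (j ∸ 1) ≡ p (j ∸ 1) ⊔ p j ⊔ p (j′ ∸ 1) ⊔ p j′ →
    p j′ ≡ p (j ∸ 1) ⊓ p j ⊓ p (j′ ∸ 1) ⊓ p j′ →
    ∃[ j″ ] (j < j″ × j″ < j′ × p j″ < p j′)

  andrePair? : ∀ j j′ → Dec (AndrePair j j′)
  andrePair? j j′ = (2 ≤? j) →-dec ((j′ ≤? length π ∸ 1) →-dec ((p (j ∸ 1) ≟ _) →-dec ((p j′ ≟ _) →-dec witness?)))
    where
    witness? : Dec (∃[ j″ ] (j < j″ × j″ < j′ × p j″ < p j′))
    witness? = map′ (λ (k , k<j′ , j<k , pk<) → k , j<k , k<j′ , pk<) (λ (k , j<k , k<j′ , pk<) → k , k<j′ , j<k , pk<)
                    (anyUpTo? (λ k → (j <? k) ×-dec (p k <? p j′)) j′)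

andreCondition2? : ∀ π → Dec (AndreCondition2 π)
andreCondition2? π = map′ unbound bound (allUpTo? (λ j′ → allUpTo? (λ j → andrePair? π j j′) j′) (suc (length π)))
  where
  Bounded : Set
  Bounded = ∀ {j′} → j′ < suc (length π) → ∀ {j} → j < j′ → AndrePair π j j′
  unbound : Bounded → AndreCondition2 π
  unbound h j j′ 2≤j j<j′ j′≤ = h (s≤s (≤-trans j′≤ (m∸n≤m (length π) 1))) j<j′ 2≤j j′≤
  bound : AndreCondition2 π → Bounded
  bound c2 _ j<j′ 2≤j j′≤ = c2 _ _ 2≤j j<j′ j′≤

isAndre? : ∀ π → Dec (IsAndre π)
isAndre? π = noDoubleDescent? π ×-dec andreCondition2? π

-- Relabelling by a strictly monotone map

StrictlyMonotone : (ℕ → ℕ) → Set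
StrictlyMonotone f = ∀ {x y} → x < y → f x < f y

module _ {f : ℕ → ℕ} (mono : StrictlyMonotone f) where

  strictMono⇒mono : ∀ {x y} → x ≤ y → f x ≤ f y
  strictMono⇒mono le with m≤n⇒m<n∨m≡n le
  ... | inj₁ lt = <⇒≤ (mono lt)
  ... | inj₂ refl = ≤-refl

  strictMono-reflects-< : ∀ {x y} → f x < f y → x < y
  strictMono-reflects-< {x} {y} lt with <-cmp x y
  ... | tri< x<y _ _ = x<y
  ... | tri≈ _ refl _ = ⊥-elim (<-irrefl refl lt)
  ... | tri> _ _ y<x = ⊥-elim (<-asym lt (mono y<x))

  strictMono⇒injective : ∀ {x y} → f x ≡ f y → x ≡ y
  strictMono⇒injective {x} {y} e with <-cmp x y
  ... | tri< x<y _ _ = ⊥-elim (<-irrefl e (mono x<y))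
  ... | tri≈ _ x≡y _ = x≡y
  ... | tri> _ _ y<x = ⊥-elim (<-irrefl (sym e) (mono y<x))

  strictMono-⊔ : ∀ x y → f (x ⊔ y) ≡ f x ⊔ f y
  strictMono-⊔ x y with ≤-total x y
  ... | inj₁ le = trans (cong f (m≤n⇒m⊔n≡n le)) (sym (m≤n⇒m⊔n≡n (strictMono⇒mono le)))
  ... | inj₂ le = trans (cong f (m≥n⇒m⊔n≡m le)) (sym (m≥n⇒m⊔n≡m (strictMono⇒mono le)))

  strictMono-⊓ : ∀ x y → f (x ⊓ y) ≡ f x ⊓ f y
  strictMono-⊓ x y with ≤-total x y
  ... | inj₁ le = trans (cong f (m≤n⇒m⊓n≡m le)) (sym (m≤n⇒m⊓n≡m (strictMono⇒mono le)))
  ... | inj₂ le = trans (cong f (m≥n⇒m⊓n≡n le)) (sym (m≥n⇒m⊓n≡n (strictMono⇒mono le)))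

  strictMono-<ᵇ : ∀ x y → (f x <ᵇ f y) ≡ (x <ᵇ y)
  strictMono-<ᵇ x y with <-cmp x y
  ... | tri< x<y _ _ = trans (<ᵇ-true (mono x<y)) (sym (<ᵇ-true x<y))
  ... | tri≈ _ refl _ = trans (<ᵇ-false {f x} ≤-refl) (sym (<ᵇ-false {x} ≤-refl))
  ... | tri> _ _ y<x = trans (<ᵇ-false (<⇒≤ (mono y<x))) (sym (<ᵇ-false (<⇒≤ y<x)))

  strictMono-max4 : ∀ x y z w → f (x ⊔ y ⊔ z ⊔ w) ≡ f x ⊔ f y ⊔ f z ⊔ f w
  strictMono-max4 x y z w =
    trans (strictMono-⊔ (x ⊔ y ⊔ z) w) (cong (_⊔ f w) (trans (strictMono-⊔ (x ⊔ y) z) (cong (_⊔ f z) (strictMono-⊔ x y))))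

  strictMono-min4 : ∀ x y z w → f (x ⊓ y ⊓ z ⊓ w) ≡ f x ⊓ f y ⊓ f z ⊓ f w
  strictMono-min4 x y z w =
    trans (strictMono-⊓ (x ⊓ y ⊓ z) w) (cong (_⊓ f w) (trans (strictMono-⊓ (x ⊓ y) z) (cong (_⊓ f z) (strictMono-⊓ x y))))

record Relabelling (π π′ : List ℕ) (K : ℕ) (f : ℕ → ℕ) : Set where
  field
    mono : StrictlyMonotone f
    agree : ∀ i → 1 ≤ i → i ≤ K → at π′ i ≡ f (at π i)
    K≤length : K ≤ length π

≤-pred∸1 : ∀ {x n} → suc x ≤ n → x ≤ n ∸ 1
≤-pred∸1 {n = suc n} (s≤s p) = p

module _ {π π′ K f} (rel : Relabelling π π′ K f) where
  open Relabelling rel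

  relabel-noDoubleDescent : NoDoubleDescent π → ∀ i → 2 + i ≤ K → ¬ (Descent π′ i × Descent π′ (suc i))
  relabel-noDoubleDescent nd i le ((1≤i , _ , d₁) , (_ , _ , d₂)) = nd i (D₁ , D₂)
    where
    le₁ : suc i ≤ K
    le₁ = ≤-trans (n≤1+n (suc i)) le
    D₁ : Descent π i
    D₁ = 1≤i , ≤-pred∸1 (≤-trans le₁ K≤length) ,
         strictMono-reflects-< mono (subst₂ _<_ (agree (suc i) (s≤s z≤n) le₁) (agree i 1≤i (≤-trans (n≤1+n i) le₁)) d₁)
    D₂ : Descent π (suc i)
    D₂ = s≤s z≤n , ≤-pred∸1 (≤-trans le K≤length) ,
         strictMono-reflects-< mono (subst₂ _<_ (agree (2 + i) (s≤s z≤n) le) (agree (suc i) (s≤s z≤n) le₁) d₂)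

  relabel-andreCondition2 : AndreCondition2 π → ∀ j j′ → 2 ≤ j → j < j′ → j′ ≤ K → j′ ≤ length π ∸ 1 →
    at π′ (j ∸ 1) ≡ at π′ (j ∸ 1) ⊔ at π′ j ⊔ at π′ (j′ ∸ 1) ⊔ at π′ j′ →
    at π′ j′ ≡ at π′ (j ∸ 1) ⊓ at π′ j ⊓ at π′ (j′ ∸ 1) ⊓ at π′ j′ →
    ∃[ j″ ] (j < j″ × j″ < j′ × at π′ j″ < at π′ j′)
  relabel-andreCondition2 c2 j@(suc (suc j₀)) j′ 2≤j@(s≤s (s≤s z≤n)) j<j′ j′≤K j′≤ isMax isMin
    with c2 j j′ 2≤j j<j′ j′≤ isMax′ isMin′
    where
    open ≡-Reasoning
    j≤K : j ≤ K
    j≤K = <⇒≤ (<-≤-trans j<j′ j′≤K)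
    x₁ x₂ x₃ x₄ : ℕ
    x₁ = at π (suc j₀)
    x₂ = at π j
    x₃ = at π (j′ ∸ 1)
    x₄ = at π j′
    e₁ : at π′ (suc j₀) ≡ f x₁
    e₁ = agree (suc j₀) (s≤s z≤n) (≤-trans (n≤1+n (suc j₀)) j≤K)
    e₂ : at π′ j ≡ f x₂
    e₂ = agree j (s≤s z≤n) j≤K
    e₃ : at π′ (j′ ∸ 1) ≡ f x₃
    e₃ = agree (j′ ∸ 1) (≤-pred∸1 (≤-trans (s≤s (s≤s z≤n)) j<j′)) (≤-trans (m∸n≤m j′ 1) j′≤K)
    e₄ : at π′ j′ ≡ f x₄
    e₄ = agree j′ (≤-trans (s≤s z≤n) j<j′) j′≤K
    isMax′ : x₁ ≡ x₁ ⊔ x₂ ⊔ x₃ ⊔ x₄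
    isMax′ = strictMono⇒injective mono (begin
      f x₁                             ≡⟨ sym e₁ ⟩
      at π′ (suc j₀)                  ≡⟨ isMax ⟩
      at π′ (suc j₀) ⊔ at π′ j ⊔ at π′ (j′ ∸ 1) ⊔ at π′ j′ ≡⟨ cong₂ _⊔_ (cong₂ _⊔_ (cong₂ _⊔_ e₁ e₂) e₃) e₄ ⟩
      f x₁ ⊔ f x₂ ⊔ f x₃ ⊔ f x₄           ≡⟨ sym (strictMono-max4 mono x₁ x₂ x₃ x₄) ⟩
      f (x₁ ⊔ x₂ ⊔ x₃ ⊔ x₄)               ∎)
    isMin′ : x₄ ≡ x₁ ⊓ x₂ ⊓ x₃ ⊓ x₄
    isMin′ = strictMono⇒injective mono (begin
      f x₄                             ≡⟨ sym e₄ ⟩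
      at π′ j′                        ≡⟨ isMin ⟩
      at π′ (suc j₀) ⊓ at π′ j ⊓ at π′ (j′ ∸ 1) ⊓ at π′ j′ ≡⟨ cong₂ _⊓_ (cong₂ _⊓_ (cong₂ _⊓_ e₁ e₂) e₃) e₄ ⟩
      f x₁ ⊓ f x₂ ⊓ f x₃ ⊓ f x₄           ≡⟨ sym (strictMono-min4 mono x₁ x₂ x₃ x₄) ⟩
      f (x₁ ⊓ x₂ ⊓ x₃ ⊓ x₄)               ∎)
  ... | j″ , j<j″ , j″<j′ , lt = j″ , j<j″ , j″<j′ ,
    subst₂ _<_ (sym (agree j″ (≤-trans (s≤s z≤n) j<j″) (≤-trans (<⇒≤ j″<j′) j′≤K)))
               (sym (agree j′ (≤-trans (s≤s z≤n) j<j′) j′≤K)) (mono lt)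

  relabel-W′ : ∀ k → k ≤ K → W′ π′ k ≡ W′ π k
  relabel-W′ zero _ = refl
  relabel-W′ (suc zero) _ = refl
  relabel-W′ (suc (suc k)) le =
    trans (cong₂ (if_then_else_ _) (cong (_++ d ∷ []) (relabel-W′ k (≤-trans (n≤1+n k) le₁)))
                                  (cong (_++ c ∷ []) (relabel-W′ (suc k) le₁)))
          (cong (λ b → if b then W′ π k ++ d ∷ [] else W′ π (suc k) ++ c ∷ []) sameDescent)
    where
    le₁ : suc k ≤ K
    le₁ = ≤-trans (n≤1+n (suc k)) le
    sameDescent : (at π′ (2 + k) <ᵇ at π′ (suc k)) ≡ (at π (2 + k) <ᵇ at π (suc k))
    sameDescent = trans (cong₂ _<ᵇ_ (agree (2 + k) (s≤s z≤n) le) (agree (suc k) (s≤s z≤n) le₁))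
                        (strictMono-<ᵇ mono (at π (2 + k)) (at π (suc k)))

-- Extending André permutations

FirstIsMax : List ℕ → ℕ → ℕ → Set
FirstIsMax π j j′ = at π (j ∸ 1) ≡ at π (j ∸ 1) ⊔ at π j ⊔ at π (j′ ∸ 1) ⊔ at π j′

LastIsMin : List ℕ → ℕ → ℕ → Set
LastIsMin π j j′ = at π j′ ≡ at π (j ∸ 1) ⊓ at π j ⊓ at π (j′ ∸ 1) ⊓ at π j′

min4≤first : ∀ x y z w → x ⊓ y ⊓ z ⊓ w ≤ x
min4≤first x y z w = ≤-trans (m⊓n≤m _ w) (≤-trans (m⊓n≤m _ z) (m⊓n≤m x y))

third≤max4 : ∀ x y z w → z ≤ x ⊔ y ⊔ z ⊔ w
third≤max4 x y z w = ≤-trans (m≤n⊔m (x ⊔ y) z) (m≤m⊔n _ w)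

appendMax : List ℕ → List ℕ
appendMax σ = σ ++ suc (length σ) ∷ []

isAndre-extend : ∀ σ π′ f → IsAndre (appendMax σ) → Relabelling (appendMax σ) π′ (suc (length σ)) f →
  (∀ i → length σ ≤ i → ¬ (Descent π′ i × Descent π′ (suc i))) →
  (∀ j j′ → 2 ≤ j → j < j′ → suc (length σ) ≤ j′ → j′ ≤ length π′ ∸ 1 → FirstIsMax π′ j j′ → ¬ LastIsMin π′ j j′) →
  IsAndre π′
isAndre-extend σ π′ f (nd , c2) rel tailNoDD tailNoPair = noDD , cond2
  where
  L : ℕ
  L = length σ
  noDD : NoDoubleDescent π′
  noDD i with suc i ≤? L
  ... | yes p = relabel-noDoubleDescent rel nd i (s≤s p)
  ... | no p = tailNoDD i (≮⇒≥ p)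
  cond2 : AndreCondition2 π′
  cond2 j j′ 2≤j j<j′ j′≤ isMax isMin with j′ ≤? L
  ... | yes p = relabel-andreCondition2 rel c2 j j′ 2≤j j<j′ (≤-trans p (n≤1+n L))
                  (subst (λ n → j′ ≤ n ∸ 1) (sym (length-∷ʳ σ _)) p) isMax isMin
  ... | no p = ⊥-elim (tailNoPair j j′ 2≤j j<j′ (≰⇒> p) j′≤ isMax isMin)

data BeyondPrefix (L i : ℕ) : Set where
  equalsL : i ≡ L → BeyondPrefix L i
  equalsL+1 : i ≡ suc L → BeyondPrefix L i
  atLeastL+2 : 2 + L ≤ i → BeyondPrefix L i

beyondPrefix : ∀ {L i} → L ≤ i → BeyondPrefix L i
beyondPrefix le with m≤n⇒m<n∨m≡n le
... | inj₂ e = equalsL (sym e)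
... | inj₁ lt with m≤n⇒m<n∨m≡n lt
... | inj₂ e = equalsL+1 (sym e)
... | inj₁ lt′ = atLeastL+2 lt′

W′-ascent : ∀ π k → (at π (2 + k) <ᵇ at π (suc k)) ≡ false → W′ π (2 + k) ≡ W′ π (suc k) ++ c ∷ []
W′-ascent π k e rewrite e = refl

W′-descent : ∀ π k → (at π (2 + k) <ᵇ at π (suc k)) ≡ true → W′ π (2 + k) ≡ W′ π k ++ d ∷ []
W′-descent π k e rewrite e = refl

W-appendMax : ∀ σ → All (_≤ length σ) σ → W (appendMax σ) ≡ W′ (appendMax σ) (length σ) ++ c ∷ []
W-appendMax [] _ = refl
W-appendMax σ@(x ∷ σ′) bnd = begin
  W′ (appendMax σ) (length (appendMax σ)) ≡⟨ cong (W′ (appendMax σ)) (length-∷ʳ σ _) ⟩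
  W′ (appendMax σ) (2 + length σ′)        ≡⟨ W′-ascent (appendMax σ) (length σ′) (<ᵇ-false lastIsMax) ⟩
  W′ (appendMax σ) (length σ) ++ c ∷ []   ∎
  where
  open ≡-Reasoning
  lastIsMax : at (appendMax σ) (length σ) ≤ at (appendMax σ) (suc (length σ))
  lastIsMax = subst₂ _≤_ (sym (at-++ˡ σ _ (length σ) (s≤s z≤n) ≤-refl)) (sym (at-∷ʳ σ _))
                (≤-trans (at-All σ (length σ) bnd (s≤s z≤n) ≤-refl) (n≤1+n _))

module AppendMax (σ : List ℕ) (bnd : All (_≤ length σ) σ) (andre : IsAndre (appendMax σ)) where
  private
    L : ℕ
    L = length σ
    π : List ℕ
    π = appendMax σ
    π′ : List ℕ
    π′ = appendMax π
    length-π : length π ≡ suc L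
    length-π = length-∷ʳ σ (suc L)
    length-π′ : length π′ ≡ 2 + L
    length-π′ = trans (length-∷ʳ π _) (cong suc length-π)
    at-prefix : ∀ i → 1 ≤ i → i ≤ suc L → at π′ i ≡ at π i
    at-prefix i 1≤i le = at-++ˡ π _ i 1≤i (subst (i ≤_) (sym length-π) le)
    rel : Relabelling π π′ (suc L) (λ x → x)
    rel = record { mono = λ p → p ; agree = at-prefix ; K≤length = ≤-reflexive (sym length-π) }
    at-L+1 : at π′ (suc L) ≡ suc L
    at-L+1 = trans (at-prefix (suc L) (s≤s z≤n) ≤-refl) (at-∷ʳ σ (suc L))
    at-L+2 : at π′ (2 + L) ≡ 2 + L
    at-L+2 = trans (cong (λ n → at π′ (suc n)) (sym length-π)) (trans (at-∷ʳ π _) (cong suc length-π))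
    tailNoDD : ∀ i → L ≤ i → ¬ (Descent π′ i × Descent π′ (suc i))
    tailNoDD i L≤i (_ , (_ , le , d₂)) with beyondPrefix L≤i
    ... | equalsL refl = <-asym d₂ (subst₂ _<_ (sym at-L+1) (sym at-L+2) ≤-refl)
    ... | equalsL+1 refl = <⇒≱ (n<1+n (suc L)) (subst (λ n → 2 + L ≤ n ∸ 1) length-π′ le)
    ... | atLeastL+2 p = <⇒≱ (s≤s (≤-trans (n≤1+n (suc L)) p)) (subst (λ n → suc i ≤ n ∸ 1) length-π′ le)
    tailNoPair : ∀ j j′ → 2 ≤ j → j < j′ → suc L ≤ j′ → j′ ≤ length π′ ∸ 1 → FirstIsMax π′ j j′ → ¬ LastIsMin π′ j j′
    tailNoPair (suc (suc j₀)) j′ (s≤s (s≤s z≤n)) j<j′ L<j′ j′≤ _ isMin = <⇒≱ lt ge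
      where
      j′≡L+1 : j′ ≡ suc L
      j′≡L+1 = ≤-antisym (subst (λ n → j′ ≤ n ∸ 1) length-π′ j′≤) L<j′
      j-1≤L : suc j₀ ≤ L
      j-1≤L = ≤-trans (n≤1+n (suc j₀)) (≤-pred (subst (3 + j₀ ≤_) j′≡L+1 j<j′))
      ge : at π′ j′ ≤ at π′ (suc j₀)
      ge = subst (_≤ at π′ (suc j₀)) (sym isMin) (min4≤first _ _ _ _)
      lt : at π′ (suc j₀) < at π′ j′
      lt = subst₂ _<_ (sym (trans (at-prefix (suc j₀) (s≤s z≤n) (≤-trans j-1≤L (n≤1+n L)))
                                  (at-++ˡ σ _ (suc j₀) (s≤s z≤n) j-1≤L)))
                      (sym (trans (cong (at π′) j′≡L+1) at-L+1))
                      (s≤s (at-All σ (suc j₀) bnd (s≤s z≤n) j-1≤L))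

  isAndre-appendMax : IsAndre π′
  isAndre-appendMax = isAndre-extend σ π′ (λ x → x) andre rel tailNoDD tailNoPair

  W-appendMax² : W π′ ≡ W π ++ c ∷ []
  W-appendMax² = begin
    W′ π′ (length π′)       ≡⟨ cong (W′ π′) length-π′ ⟩
    W′ π′ (2 + L)           ≡⟨ W′-ascent π′ L (trans (cong₂ _<ᵇ_ at-L+2 at-L+1) (<ᵇ-false (n≤1+n (suc L)))) ⟩
    W′ π′ (suc L) ++ c ∷ [] ≡⟨ cong (_++ c ∷ []) (relabel-W′ rel (suc L) ≤-refl) ⟩
    W′ π (suc L) ++ c ∷ []  ≡⟨ cong (λ n → W′ π n ++ c ∷ []) (sym length-π) ⟩
    W π ++ c ∷ []           ∎
    where open ≡-Reasoning

module AppendDescent (ρ : List ℕ) (x y L : ℕ) (length-ρ : length ρ ≡ L) (y<x : y < x) (x≤L+2 : x ≤ 2 + L) where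
  τ : List ℕ
  τ = ρ ++ x ∷ y ∷ []
  π′ : List ℕ
  π′ = appendMax τ

  length-τ : length τ ≡ 2 + L
  length-τ = trans (length-++ ρ) (trans (cong (_+ 2) length-ρ) (+-comm L 2))

  length-π′ : length π′ ≡ 3 + L
  length-π′ = trans (length-∷ʳ τ _) (cong suc length-τ)

  at-τ : ∀ i → 1 ≤ i → i ≤ 2 + L → at π′ i ≡ at τ i
  at-τ i 1≤i le = at-++ˡ τ _ i 1≤i (subst (i ≤_) (sym length-τ) le)

  at-ρ : ∀ i → 1 ≤ i → i ≤ L → at π′ i ≡ at ρ i
  at-ρ i 1≤i le = trans (at-τ i 1≤i (≤-trans le (≤-trans (n≤1+n L) (n≤1+n (suc L)))))
                        (at-++ˡ ρ _ i 1≤i (subst (i ≤_) (sym length-ρ) le))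

  at-L+1 : at π′ (suc L) ≡ x
  at-L+1 = trans (at-τ (suc L) (s≤s z≤n) (n≤1+n (suc L)))
                 (trans (cong (λ n → at τ (suc n)) (sym length-ρ)) (at-++ʳ ρ _ 0))

  at-L+2 : at π′ (2 + L) ≡ y
  at-L+2 = trans (at-τ (2 + L) (s≤s z≤n) ≤-refl) (trans (cong (λ n → at τ (2 + n)) (sym length-ρ)) (at-++ʳ ρ _ 1))

  at-L+3 : at π′ (3 + L) ≡ 3 + L
  at-L+3 = trans (cong (λ n → at π′ (suc n)) (sym length-τ)) (trans (at-∷ʳ τ _) (cong suc length-τ))

  tailPositions : ∀ j′ → suc L ≤ j′ → j′ ≤ length π′ ∸ 1 → (j′ ≡ suc L) ⊎ (j′ ≡ 2 + L)
  tailPositions j′ le₁ le₂ with beyondPrefix le₁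
  ... | equalsL e = inj₁ e
  ... | equalsL+1 e = inj₂ e
  ... | atLeastL+2 p = ⊥-elim (<⇒≱ (s≤s (s≤s ≤-refl)) (≤-trans p (subst (λ n → j′ ≤ n ∸ 1) length-π′ le₂)))

  tailNoDoubleDescent : ¬ Descent π′ L → ∀ i → L ≤ i → ¬ (Descent π′ i × Descent π′ (suc i))
  tailNoDoubleDescent noDescentL i L≤i (D₁ , (_ , le , d₂)) with beyondPrefix L≤i
  ... | equalsL refl = noDescentL D₁
  ... | equalsL+1 refl = <⇒≱ (subst₂ _<_ at-L+3 at-L+2 d₂) (≤-trans (<⇒≤ y<x) (≤-trans x≤L+2 (n≤1+n _)))
  ... | atLeastL+2 p = <⇒≱ (s≤s p) (subst (λ n → suc i ≤ n ∸ 1) length-π′ le)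

  prefixBeforeTail : ∀ j₀ j′ → 2 + j₀ < j′ → j′ ≤ length π′ ∸ 1 → suc j₀ ≤ L
  prefixBeforeTail j₀ j′ lt le = ≤-pred (≤-pred (≤-trans lt (subst (λ n → j′ ≤ n ∸ 1) length-π′ le)))

  W-appendDescent : ∀ {π f} → Relabelling π π′ (suc L) f → W π′ ≡ (W′ π L ++ d ∷ []) ++ c ∷ []
  W-appendDescent rel = begin
    W′ π′ (length π′)                 ≡⟨ cong (W′ π′) length-π′ ⟩
    W′ π′ (3 + L)                     ≡⟨ W′-ascent π′ (suc L) (trans (cong₂ _<ᵇ_ at-L+3 at-L+2) (<ᵇ-false y≤L+3)) ⟩
    W′ π′ (2 + L) ++ c ∷ []           ≡⟨ cong (_++ c ∷ []) (W′-descent π′ L (trans (cong₂ _<ᵇ_ at-L+2 at-L+1) (<ᵇ-true y<x))) ⟩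
    (W′ π′ L ++ d ∷ []) ++ c ∷ []     ≡⟨ cong (λ v → (v ++ d ∷ []) ++ c ∷ []) (relabel-W′ rel L (n≤1+n L)) ⟩
    (W′ _ L ++ d ∷ []) ++ c ∷ []      ∎
    where
    open ≡-Reasoning
    y≤L+3 : y ≤ 3 + L
    y≤L+3 = ≤-trans (<⇒≤ y<x) (≤-trans x≤L+2 (n≤1+n _))

module AppendDescentHigh (σ : List ℕ) (bnd : All (_≤ length σ) σ) (andre : IsAndre (appendMax σ)) where
  private
    L : ℕ
    L = length σ
    π : List ℕ
    π = appendMax σ
  open AppendDescent σ (2 + L) (suc L) L refl ≤-refl ≤-refl public

  private
    f : ℕ → ℕ
    f v = if v <ᵇ suc L then v else suc v
    f-low : ∀ {v} → v ≤ L → f v ≡ v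
    f-low le rewrite <ᵇ-true (s≤s le) = refl
    f-high : ∀ {v} → suc L ≤ v → f v ≡ suc v
    f-high le rewrite <ᵇ-false le = refl
    f-mono : StrictlyMonotone f
    f-mono {x} {y} x<y with x ≤? L | y ≤? L
    ... | yes x≤L | yes y≤L = subst₂ _<_ (sym (f-low x≤L)) (sym (f-low y≤L)) x<y
    ... | yes x≤L | no y≰L = subst₂ _<_ (sym (f-low x≤L)) (sym (f-high (≰⇒> y≰L))) (≤-trans x<y (n≤1+n y))
    ... | no x≰L | yes y≤L = ⊥-elim (x≰L (≤-trans (<⇒≤ x<y) y≤L))
    ... | no x≰L | no y≰L = subst₂ _<_ (sym (f-high (≰⇒> x≰L))) (sym (f-high (≰⇒> y≰L))) (s≤s x<y)
    agree : ∀ i → 1 ≤ i → i ≤ suc L → at π′ i ≡ f (at π i)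
    agree i 1≤i le with m≤n⇒m<n∨m≡n le
    ... | inj₁ (s≤s i≤L) = trans (at-ρ i 1≤i i≤L)
                             (trans (sym (f-low (at-All σ i bnd 1≤i i≤L))) (cong f (sym (at-++ˡ σ _ i 1≤i i≤L))))
    ... | inj₂ refl = trans at-L+1 (trans (sym (f-high ≤-refl)) (cong f (sym (at-∷ʳ σ (suc L)))))
    rel : Relabelling π π′ (suc L) f
    rel = record { mono = f-mono ; agree = agree ; K≤length = ≤-reflexive (sym (length-∷ʳ σ _)) }
    noDescentL : ¬ Descent π′ L
    noDescentL (1≤L , _ , d₁) =
      <-asym d₁ (subst₂ _<_ (sym (at-ρ L 1≤L ≤-refl)) (sym at-L+1) (s≤s (≤-trans (at-All σ L bnd 1≤L ≤-refl) (n≤1+n L))))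
    tailNoPair : ∀ j j′ → 2 ≤ j → j < j′ → suc L ≤ j′ → j′ ≤ length π′ ∸ 1 → FirstIsMax π′ j j′ → ¬ LastIsMin π′ j j′
    tailNoPair (suc (suc j₀)) j′ (s≤s (s≤s z≤n)) j<j′ L<j′ j′≤ _ isMin = <⇒≱ lt ge
      where
      j-1≤L : suc j₀ ≤ L
      j-1≤L = prefixBeforeTail j₀ j′ j<j′ j′≤
      ge : at π′ j′ ≤ at π′ (suc j₀)
      ge = subst (_≤ at π′ (suc j₀)) (sym isMin) (min4≤first _ _ _ _)
      tailLarge : suc L ≤ at π′ j′
      tailLarge with tailPositions j′ L<j′ j′≤
      ... | inj₁ refl = subst (suc L ≤_) (sym at-L+1) (n≤1+n (suc L))
      ... | inj₂ refl = subst (suc L ≤_) (sym at-L+2) ≤-refl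
      lt : at π′ (suc j₀) < at π′ j′
      lt = ≤-trans (s≤s (subst (_≤ L) (sym (at-ρ (suc j₀) (s≤s z≤n) j-1≤L)) (at-All σ (suc j₀) bnd (s≤s z≤n) j-1≤L))) tailLarge

  isAndre-appendDescentHigh : IsAndre π′
  isAndre-appendDescentHigh = isAndre-extend σ π′ f andre rel (tailNoDoubleDescent noDescentL) tailNoPair

  W-appendDescentHigh : W π′ ≡ (W′ π L ++ d ∷ []) ++ c ∷ []
  W-appendDescentHigh = W-appendDescent rel

module AppendDescentLow (σ : List ℕ) (bnd : All (_≤ length σ) σ) (andre : IsAndre (appendMax σ)) where
  private
    L : ℕ
    L = length σ
    π : List ℕ
    π = appendMax σ
  open AppendDescent (map suc σ) (2 + L) 1 L (length-map suc σ) (s≤s (s≤s z≤n)) ≤-refl public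

  private
    at-shifted : ∀ i → 1 ≤ i → i ≤ L → at π′ i ≡ suc (at σ i)
    at-shifted i 1≤i le = trans (at-ρ i 1≤i le) (at-map suc σ i 1≤i le)
    agree : ∀ i → 1 ≤ i → i ≤ suc L → at π′ i ≡ suc (at π i)
    agree i 1≤i le with m≤n⇒m<n∨m≡n le
    ... | inj₁ (s≤s i≤L) = trans (at-shifted i 1≤i i≤L) (cong suc (sym (at-++ˡ σ _ i 1≤i i≤L)))
    ... | inj₂ refl = trans at-L+1 (cong suc (sym (at-∷ʳ σ (suc L))))
    rel : Relabelling π π′ (suc L) suc
    rel = record { mono = s≤s ; agree = agree ; K≤length = ≤-reflexive (sym (length-∷ʳ σ _)) }
    prefixSmall : ∀ i → 1 ≤ i → i ≤ L → at π′ i ≤ suc L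
    prefixSmall i 1≤i le = subst (_≤ suc L) (sym (at-shifted i 1≤i le)) (s≤s (at-All σ i bnd 1≤i le))
    noDescentL : ¬ Descent π′ L
    noDescentL (1≤L , _ , d₁) = <-asym d₁ (subst (at π′ L <_) (sym at-L+1) (s≤s (prefixSmall L 1≤L ≤-refl)))
    tailNoPair : ∀ j j′ → 2 ≤ j → j < j′ → suc L ≤ j′ → j′ ≤ length π′ ∸ 1 → FirstIsMax π′ j j′ → ¬ LastIsMin π′ j j′
    tailNoPair (suc (suc j₀)) j′ (s≤s (s≤s z≤n)) j<j′ L<j′ j′≤ isMax isMin with tailPositions j′ L<j′ j′≤
    ... | inj₁ refl = <⇒≱ (≤-trans (s≤s (prefixSmall (suc j₀) (s≤s z≤n) j-1≤L)) (≤-reflexive (sym at-L+1))) ge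
      where
      j-1≤L : suc j₀ ≤ L
      j-1≤L = prefixBeforeTail j₀ j′ j<j′ j′≤
      ge : at π′ (suc L) ≤ at π′ (suc j₀)
      ge = subst (_≤ at π′ (suc j₀)) (sym isMin) (min4≤first _ _ _ _)
    ... | inj₂ refl = <⇒≱ (≤-trans (s≤s (prefixSmall (suc j₀) (s≤s z≤n) j-1≤L)) (≤-reflexive (sym at-L+1))) ge
      where
      j-1≤L : suc j₀ ≤ L
      j-1≤L = prefixBeforeTail j₀ (2 + L) j<j′ j′≤
      ge : at π′ (suc L) ≤ at π′ (suc j₀)
      ge = subst (at π′ (suc L) ≤_) (sym isMax) (third≤max4 (at π′ (suc j₀)) (at π′ (2 + j₀)) (at π′ (suc L)) (at π′ (2 + L)))

  isAndre-appendDescentLow : IsAndre π′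
  isAndre-appendDescentLow = isAndre-extend σ π′ suc andre rel (tailNoDoubleDescent noDescentL) tailNoPair

  W-appendDescentLow : W π′ ≡ (W′ π L ++ d ∷ []) ++ c ∷ []
  W-appendDescentLow = W-appendDescent rel

range : ℕ → List ℕ
range n = map suc (upTo n)

range-∷ʳ : ∀ n → range (suc n) ≡ range n ++ suc n ∷ []
range-∷ʳ n = trans (cong (map suc) (sym (upTo-∷ʳ n))) (map-++ suc (upTo n) (n ∷ []))

range-suc : ∀ n → range (suc n) ≡ 1 ∷ map suc (range n)
range-suc n = cong (λ xs → 1 ∷ map suc xs) (sym (map-applyUpTo (λ i → i) suc n))

↭-range⇒bounded : ∀ {σ n} → σ ↭ range n → All (_≤ n) σ
↭-range⇒bounded {n = n} p = All-resp-↭ (↭-sym p) (Allₚ.map⁺ (Allₚ.applyUpTo⁺₁ (λ i → i) n (λ i<n → i<n)))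

appendDescentHigh : List ℕ → List ℕ
appendDescentHigh σ = σ ++ 2 + length σ ∷ suc (length σ) ∷ []

appendDescentLow : List ℕ → List ℕ
appendDescentLow σ = map suc σ ++ 2 + length σ ∷ 1 ∷ []

-- The cd-word is stored reversed, since every step appends letters at the end of the permutation.
record AndrePrefix (r : List CD) (σ : List ℕ) : Set where
  field
    length≡deg : length σ ≡ degCD r
    perm : σ ↭ range (length σ)
    andre : IsAndre (appendMax σ)
    cdType : W (appendMax σ) ≡ reverse r ++ c ∷ []

  bounded : All (_≤ length σ) σ
  bounded = ↭-range⇒bounded perm

  appendMax-perm : appendMax σ ↭ range (suc (length σ))
  appendMax-perm = subst (appendMax σ ↭_) (sym (range-∷ʳ (length σ))) (++⁺ʳ _ perm)

  W′-prefix : W′ (appendMax σ) (length σ) ≡ reverse r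
  W′-prefix = ∷ʳ-injectiveˡ _ _ (trans (sym (W-appendMax σ bounded)) cdType)

checkedAndrePrefix : ∀ r σ → length σ ≡ degCD r → σ ↭ range (length σ) →
  {_ : True (isAndre? (appendMax σ))} → W (appendMax σ) ≡ reverse r ++ c ∷ [] → AndrePrefix r σ
checkedAndrePrefix r σ len perm {isAndre} cdType = record
  { length≡deg = len ; perm = perm ; andre = toWitness isAndre ; cdType = cdType }

module _ {r σ} (P : AndrePrefix r σ) where
  open AndrePrefix P
  private
    L : ℕ
    L = length σ

  andrePrefix-appendMax : AndrePrefix (c ∷ r) (appendMax σ)
  andrePrefix-appendMax = record
    { length≡deg = trans (length-∷ʳ σ _) (cong suc length≡deg)
    ; perm = subst (λ n → appendMax σ ↭ range n) (sym (length-∷ʳ σ _)) appendMax-perm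
    ; andre = AppendMax.isAndre-appendMax σ bounded andre
    ; cdType = trans (AppendMax.W-appendMax² σ bounded andre)
                     (trans (cong (_++ c ∷ []) cdType) (cong (_++ c ∷ []) (sym (unfold-reverse c r))))
    }

  andrePrefix-appendDescentHigh : AndrePrefix (d ∷ r) (appendDescentHigh σ)
  andrePrefix-appendDescentHigh = record
    { length≡deg = trans length-τ (cong (2 +_) length≡deg)
    ; perm = subst (λ n → appendDescentHigh σ ↭ range n) (sym length-τ) perm′
    ; andre = isAndre-appendDescentHigh
    ; cdType = trans W-appendDescentHigh
                     (trans (cong (λ v → (v ++ d ∷ []) ++ c ∷ []) W′-prefix) (cong (_++ c ∷ []) (sym (unfold-reverse d r))))
    }
    where
    open AppendDescentHigh σ bounded andre using (length-τ; isAndre-appendDescentHigh; W-appendDescentHigh)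
    range-L+2 : range (2 + L) ≡ range L ++ suc L ∷ 2 + L ∷ []
    range-L+2 = trans (range-∷ʳ (suc L)) (trans (cong (_++ 2 + L ∷ []) (range-∷ʳ L)) (++-assoc (range L) _ _))
    perm′ : appendDescentHigh σ ↭ range (2 + L)
    perm′ = subst (appendDescentHigh σ ↭_) (sym range-L+2) (++⁺ perm (swap _ _ ↭-refl))

  andrePrefix-appendDescentLow : AndrePrefix (d ∷ r) (appendDescentLow σ)
  andrePrefix-appendDescentLow = record
    { length≡deg = trans length-τ (cong (2 +_) length≡deg)
    ; perm = subst (λ n → appendDescentLow σ ↭ range n) (sym length-τ) perm′
    ; andre = isAndre-appendDescentLow
    ; cdType = trans W-appendDescentLow
                     (trans (cong (λ v → (v ++ d ∷ []) ++ c ∷ []) W′-prefix) (cong (_++ c ∷ []) (sym (unfold-reverse d r))))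
    }
    where
    open AppendDescentLow σ bounded andre using (length-τ; isAndre-appendDescentLow; W-appendDescentLow)
    perm′ : appendDescentLow σ ↭ range (2 + L)
    perm′ = begin
      map suc σ ++ 2 + L ∷ 1 ∷ []   ↭⟨ ++⁺ˡ (map suc σ) (swap (2 + L) 1 ↭-refl) ⟩
      map suc σ ++ 1 ∷ 2 + L ∷ []   ↭⟨ shift 1 (map suc σ) (2 + L ∷ []) ⟩
      1 ∷ map suc σ ++ 2 + L ∷ []   ≡⟨ cong (1 ∷_) (sym (map-++ suc σ (suc L ∷ []))) ⟩
      1 ∷ map suc (appendMax σ)     ↭⟨ prep 1 (map⁺ suc appendMax-perm) ⟩
      1 ∷ map suc (range (suc L))   ≡⟨ sym (range-suc (suc L)) ⟩
      range (2 + L)                 ∎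
      where open PermutationReasoning

andrePrefixes : List CD → List (List ℕ)
andrePrefixes [] = [] ∷ []
andrePrefixes (c ∷ []) = map appendMax ([] ∷ [])
andrePrefixes (c ∷ c ∷ r) = map appendMax (andrePrefixes (c ∷ r))
andrePrefixes (c ∷ d ∷ []) = (2 ∷ 1 ∷ 3 ∷ []) ∷ (3 ∷ 1 ∷ 2 ∷ []) ∷ []
andrePrefixes (c ∷ d ∷ x ∷ r) = map appendMax (andrePrefixes (d ∷ x ∷ r))
andrePrefixes (d ∷ []) = (2 ∷ 1 ∷ []) ∷ []
andrePrefixes (d ∷ c ∷ r) = map appendDescentHigh (andrePrefixes (c ∷ r)) ++ map appendDescentLow (andrePrefixes (c ∷ r))
andrePrefixes (d ∷ d ∷ []) = (2 ∷ 1 ∷ 4 ∷ 3 ∷ []) ∷ (3 ∷ 1 ∷ 4 ∷ 2 ∷ []) ∷ (3 ∷ 2 ∷ 4 ∷ 1 ∷ []) ∷ (4 ∷ 1 ∷ 3 ∷ 2 ∷ []) ∷ []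
andrePrefixes (d ∷ d ∷ x ∷ r) = map appendDescentHigh (andrePrefixes (d ∷ x ∷ r)) ++ map appendDescentLow (andrePrefixes (d ∷ x ∷ r))

andrePrefixes-valid : ∀ r → All (AndrePrefix r) (andrePrefixes r)
andrePrefixes-valid [] = checkedAndrePrefix [] [] refl ↭-refl refl ∷ []
andrePrefixes-valid (c ∷ []) = Allₚ.gmap⁺ andrePrefix-appendMax (andrePrefixes-valid [])
andrePrefixes-valid (c ∷ c ∷ r) = Allₚ.gmap⁺ andrePrefix-appendMax (andrePrefixes-valid (c ∷ r))
andrePrefixes-valid (c ∷ d ∷ []) =
    checkedAndrePrefix (c ∷ d ∷ []) (2 ∷ 1 ∷ 3 ∷ []) refl (swap 2 1 ↭-refl) refl
  ∷ checkedAndrePrefix (c ∷ d ∷ []) (3 ∷ 1 ∷ 2 ∷ []) refl (↭-trans (swap 3 1 ↭-refl) (prep 1 (swap 3 2 ↭-refl))) refl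
  ∷ []
andrePrefixes-valid (c ∷ d ∷ x ∷ r) = Allₚ.gmap⁺ andrePrefix-appendMax (andrePrefixes-valid (d ∷ x ∷ r))
andrePrefixes-valid (d ∷ []) = checkedAndrePrefix (d ∷ []) (2 ∷ 1 ∷ []) refl (swap 2 1 ↭-refl) refl ∷ []
andrePrefixes-valid (d ∷ c ∷ r) =
  Allₚ.++⁺ (Allₚ.gmap⁺ andrePrefix-appendDescentHigh (andrePrefixes-valid (c ∷ r)))
          (Allₚ.gmap⁺ andrePrefix-appendDescentLow (andrePrefixes-valid (c ∷ r)))
andrePrefixes-valid (d ∷ d ∷ []) =
    checkedAndrePrefix (d ∷ d ∷ []) (2 ∷ 1 ∷ 4 ∷ 3 ∷ []) refl
      (↭-trans (swap 2 1 ↭-refl) (prep 1 (prep 2 (swap 4 3 ↭-refl)))) refl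
  ∷ checkedAndrePrefix (d ∷ d ∷ []) (3 ∷ 1 ∷ 4 ∷ 2 ∷ []) refl
      (↭-trans (swap 3 1 ↭-refl) (↭-trans (prep 1 (prep 3 (swap 4 2 ↭-refl))) (prep 1 (swap 3 2 ↭-refl)))) refl
  ∷ checkedAndrePrefix (d ∷ d ∷ []) (3 ∷ 2 ∷ 4 ∷ 1 ∷ []) refl
      (↭-trans (swap 3 2 ↭-refl) (↭-trans (prep 2 (prep 3 (swap 4 1 ↭-refl)))
        (↭-trans (prep 2 (swap 3 1 ↭-refl)) (swap 2 1 ↭-refl)))) refl
  ∷ checkedAndrePrefix (d ∷ d ∷ []) (4 ∷ 1 ∷ 3 ∷ 2 ∷ []) refl
      (↭-trans (swap 4 1 ↭-refl) (↭-trans (prep 1 (swap 4 3 ↭-refl))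
        (↭-trans (prep 1 (prep 3 (swap 4 2 ↭-refl))) (prep 1 (swap 3 2 ↭-refl))))) refl
  ∷ []
andrePrefixes-valid (d ∷ d ∷ x ∷ r) =
  Allₚ.++⁺ (Allₚ.gmap⁺ andrePrefix-appendDescentHigh (andrePrefixes-valid (d ∷ x ∷ r)))
          (Allₚ.gmap⁺ andrePrefix-appendDescentLow (andrePrefixes-valid (d ∷ x ∷ r)))

appendMax-injective : ∀ {σ₁ σ₂} → appendMax σ₁ ≡ appendMax σ₂ → σ₁ ≡ σ₂
appendMax-injective {σ₁} {σ₂} = ∷ʳ-injectiveˡ σ₁ σ₂

append₂-injective : ∀ {σ₁ σ₂ : List ℕ} {x₁ y₁ x₂ y₂} → σ₁ ++ x₁ ∷ y₁ ∷ [] ≡ σ₂ ++ x₂ ∷ y₂ ∷ [] → σ₁ ≡ σ₂ × y₁ ≡ y₂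
append₂-injective {σ₁} {σ₂} {x₁} {y₁} {x₂} {y₂} e
  with ∷ʳ-injective (σ₁ ++ x₁ ∷ []) (σ₂ ++ x₂ ∷ []) (trans (++-assoc σ₁ _ _) (trans e (sym (++-assoc σ₂ _ _))))
... | e₁ , e₂ = ∷ʳ-injectiveˡ σ₁ σ₂ e₁ , e₂

appendDescentHigh-injective : ∀ {σ₁ σ₂} → appendDescentHigh σ₁ ≡ appendDescentHigh σ₂ → σ₁ ≡ σ₂
appendDescentHigh-injective e = proj₁ (append₂-injective e)

appendDescentLow-injective : ∀ {σ₁ σ₂} → appendDescentLow σ₁ ≡ appendDescentLow σ₂ → σ₁ ≡ σ₂
appendDescentLow-injective e = map-injective suc-injective (proj₁ (append₂-injective e))

appendDescentHigh≢Low : ∀ {σ₁ σ₂} → 1 ≤ length σ₁ → appendDescentHigh σ₁ ≢ appendDescentLow σ₂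
appendDescentHigh≢Low 1≤L e = <⇒≢ 1≤L (sym (suc-injective (proj₂ (append₂-injective e))))

andrePrefixes-nonempty : ∀ r → 1 ≤ degCD r → All (λ σ → 1 ≤ length σ) (andrePrefixes r)
andrePrefixes-nonempty r 1≤deg =
  All.map (λ P → subst (1 ≤_) (sym (AndrePrefix.length≡deg P)) 1≤deg) (andrePrefixes-valid r)

module _ (r : List CD) (1≤deg : 1 ≤ degCD r) where

  unique-appendDescents : Unique (andrePrefixes r) →
    Unique (map appendDescentHigh (andrePrefixes r) ++ map appendDescentLow (andrePrefixes r))
  unique-appendDescents u =
    Uniqueₚ.++⁺ (Uniqueₚ.map⁺ appendDescentHigh-injective u) (Uniqueₚ.map⁺ appendDescentLow-injective u) disjoint
    where
    disjoint : ∀ {v} → v ∈ map appendDescentHigh (andrePrefixes r) × v ∈ map appendDescentLow (andrePrefixes r) → ⊥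
    disjoint (v∈high , v∈low) with ∈-map⁻ appendDescentHigh v∈high | ∈-map⁻ appendDescentLow v∈low
    ... | σ₁ , σ₁∈ , refl | σ₂ , _ , e = appendDescentHigh≢Low (All.lookup (andrePrefixes-nonempty r 1≤deg) σ₁∈) e

andrePrefixes-unique : ∀ r → Unique (andrePrefixes r)
andrePrefixes-unique [] = [] ∷ []
andrePrefixes-unique (c ∷ []) = [] ∷ []
andrePrefixes-unique (c ∷ c ∷ r) = Uniqueₚ.map⁺ appendMax-injective (andrePrefixes-unique (c ∷ r))
andrePrefixes-unique (c ∷ d ∷ []) = ((λ ()) ∷ []) ∷ [] ∷ []
andrePrefixes-unique (c ∷ d ∷ x ∷ r) = Uniqueₚ.map⁺ appendMax-injective (andrePrefixes-unique (d ∷ x ∷ r))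
andrePrefixes-unique (d ∷ []) = [] ∷ []
andrePrefixes-unique (d ∷ c ∷ r) = unique-appendDescents (c ∷ r) (s≤s z≤n) (andrePrefixes-unique (c ∷ r))
andrePrefixes-unique (d ∷ d ∷ []) =
  ((λ ()) ∷ (λ ()) ∷ (λ ()) ∷ []) ∷ ((λ ()) ∷ (λ ()) ∷ []) ∷ ((λ ()) ∷ []) ∷ [] ∷ []
andrePrefixes-unique (d ∷ d ∷ x ∷ r) = unique-appendDescents (d ∷ x ∷ r) (s≤s z≤n) (andrePrefixes-unique (d ∷ x ∷ r))

length-appendDescents : ∀ L → length (map appendDescentHigh L ++ map appendDescentLow L) ≡ 2 * length L
length-appendDescents L =
  trans (length-++ (map appendDescentHigh L))
        (trans (cong₂ _+_ (length-map appendDescentHigh L) (length-map appendDescentLow L))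
               (cong (length L +_) (sym (+-identityʳ (length L)))))

andrePrefixes-length : ∀ r → r ≢ d ∷ [] → 2 ^ countD r ≤ length (andrePrefixes r)
andrePrefixes-length [] _ = ≤-refl
andrePrefixes-length (c ∷ []) _ = ≤-refl
andrePrefixes-length (c ∷ c ∷ r) _ =
  subst (2 ^ countD r ≤_) (sym (length-map appendMax (andrePrefixes (c ∷ r)))) (andrePrefixes-length (c ∷ r) (λ ()))
andrePrefixes-length (c ∷ d ∷ []) _ = ≤-refl
andrePrefixes-length (c ∷ d ∷ x ∷ r) _ =
  subst (2 ^ countD (d ∷ x ∷ r) ≤_) (sym (length-map appendMax (andrePrefixes (d ∷ x ∷ r))))
        (andrePrefixes-length (d ∷ x ∷ r) (λ ()))
andrePrefixes-length (d ∷ []) r≢d = ⊥-elim (r≢d refl)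
andrePrefixes-length (d ∷ c ∷ r) _ =
  subst (2 * 2 ^ countD r ≤_) (sym (length-appendDescents (andrePrefixes (c ∷ r))))
        (*-monoʳ-≤ 2 (andrePrefixes-length (c ∷ r) (λ ())))
andrePrefixes-length (d ∷ d ∷ []) _ = ≤-refl
andrePrefixes-length (d ∷ d ∷ x ∷ r) _ =
  subst (2 * 2 ^ countD (d ∷ x ∷ r) ≤_) (sym (length-appendDescents (andrePrefixes (d ∷ x ∷ r))))
        (*-monoʳ-≤ 2 (andrePrefixes-length (d ∷ x ∷ r) (λ ())))

andrePermutations-endingInMax : ∀ n w → degCD w ≡ n → w ≢ d ∷ [] →
  ∃[ Ps ] (Unique Ps × 2 ^ countD w ≤ length Ps ×
           All (λ π → IsPermutationOf (suc n) π × IsAndre π × W π ≡ w ++ c ∷ [] × at π (suc n) ≡ suc n) Ps)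
andrePermutations-endingInMax n w deg w≢d =
  map appendMax (andrePrefixes r) ,
  Uniqueₚ.map⁺ appendMax-injective (andrePrefixes-unique r) ,
  subst₂ _≤_ (cong (2 ^_) (countD-reverse w)) (sym (length-map appendMax (andrePrefixes r)))
             (andrePrefixes-length r (λ r≡d → w≢d (trans (sym (reverse-involutive w)) (cong reverse r≡d)))) ,
  Allₚ.gmap⁺ endsInMax (andrePrefixes-valid r)
  where
  r : List CD
  r = reverse w
  endsInMax : ∀ {σ} → AndrePrefix r σ →
    IsPermutationOf (suc n) (appendMax σ) × IsAndre (appendMax σ) ×
    W (appendMax σ) ≡ w ++ c ∷ [] × at (appendMax σ) (suc n) ≡ suc n
  endsInMax {σ} P =
    subst (λ n → appendMax σ ↭ range (suc n)) length≡ appendMax-perm ,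
    andre ,
    trans cdType (cong (_++ c ∷ []) (reverse-involutive w)) ,
    subst (λ n → at (appendMax σ) (suc n) ≡ suc n) length≡ (at-∷ʳ σ _)
    where
    open AndrePrefix P
    length≡ : length σ ≡ n
    length≡ = trans length≡deg (trans (degCD-reverse w) deg)

module _ {A : Set} where

  sumℕ-cong : ∀ {f g : A → ℕ} → (∀ x → f x ≡ g x) → ∀ xs → sumℕ (map f xs) ≡ sumℕ (map g xs)
  sumℕ-cong e [] = refl
  sumℕ-cong e (x ∷ xs) = cong₂ _+_ (e x) (sumℕ-cong e xs)

  sumℕ-map-∘ : ∀ {B : Set} (f : B → ℕ) (g : A → B) xs → sumℕ (map f (map g xs)) ≡ sumℕ (map (λ x → f (g x)) xs)
  sumℕ-map-∘ f g xs = cong sumℕ (sym (map-∘ xs))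

  sumℕ-++ : ∀ (f : A → ℕ) xs ys → sumℕ (map f (xs ++ ys)) ≡ sumℕ (map f xs) + sumℕ (map f ys)
  sumℕ-++ f [] ys = refl
  sumℕ-++ f (x ∷ xs) ys = trans (cong (f x +_) (sumℕ-++ f xs ys)) (sym (+-assoc (f x) _ _))

  sumℕ-+ : ∀ (f g : A → ℕ) xs → sumℕ (map (λ x → f x + g x) xs) ≡ sumℕ (map f xs) + sumℕ (map g xs)
  sumℕ-+ f g [] = refl
  sumℕ-+ f g (x ∷ xs) = trans (cong (f x + g x +_) (sumℕ-+ f g xs)) (+-interchange (f x) (g x) _ _)

  sumℕ-*ˡ : ∀ k (f : A → ℕ) xs → sumℕ (map (λ x → k * f x) xs) ≡ k * sumℕ (map f xs)
  sumℕ-*ˡ k f [] = sym (*-zeroʳ k)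
  sumℕ-*ˡ k f (x ∷ xs) = trans (cong (k * f x +_) (sumℕ-*ˡ k f xs)) (sym (*-distribˡ-+ k (f x) _))

  sumℕ-*ʳ : ∀ k (f : A → ℕ) xs → sumℕ (map (λ x → f x * k) xs) ≡ sumℕ (map f xs) * k
  sumℕ-*ʳ k f [] = refl
  sumℕ-*ʳ k f (x ∷ xs) = trans (cong (f x * k +_) (sumℕ-*ʳ k f xs)) (sym (*-distribʳ-+ k (f x) _))

  sumℕ-zero : ∀ {f : A → ℕ} → (∀ x → f x ≡ 0) → ∀ xs → sumℕ (map f xs) ≡ 0
  sumℕ-zero e [] = refl
  sumℕ-zero e (x ∷ xs) = cong₂ _+_ (e x) (sumℕ-zero e xs)

sumℕ-concatMap : ∀ {A B : Set} (f : B → ℕ) (g : A → List B) xs →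
  sumℕ (map f (concatMap g xs)) ≡ sumℕ (map (λ x → sumℕ (map f (g x))) xs)
sumℕ-concatMap f g [] = refl
sumℕ-concatMap f g (x ∷ xs) = trans (sumℕ-++ f (g x) (concatMap g xs)) (cong (sumℕ (map f (g x)) +_) (sumℕ-concatMap f g xs))

-- cd-monomials in the basis of flag f-numbers

-- Coefficient of u in v(a + 2b, ab + ba + 2bb).  Substituting a ↦ a + b into the ab-index
-- Σ h_S u_S gives Σ f_T u_T, so this is the flag-f analogue of expandCoeff.
fExpandCoeff : List CD → List AB → ℕ
fExpandCoeff [] [] = 1
fExpandCoeff [] (_ ∷ _) = 0
fExpandCoeff (c ∷ v) [] = 0
fExpandCoeff (c ∷ v) (a ∷ u) = fExpandCoeff v u
fExpandCoeff (c ∷ v) (b ∷ u) = 2 * fExpandCoeff v u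
fExpandCoeff (d ∷ v) [] = 0
fExpandCoeff (d ∷ v) (_ ∷ []) = 0
fExpandCoeff (d ∷ v) (a ∷ a ∷ u) = 0
fExpandCoeff (d ∷ v) (a ∷ b ∷ u) = fExpandCoeff v u
fExpandCoeff (d ∷ v) (b ∷ a ∷ u) = fExpandCoeff v u
fExpandCoeff (d ∷ v) (b ∷ b ∷ u) = 2 * fExpandCoeff v u

fExpand : List (List CD) → List AB → ℕ
fExpand vs u = sumℕ (map (λ v → fExpandCoeff v u) vs)

isNil : List AB → ℕ
isNil [] = 1
isNil (_ ∷ _) = 0

-- Flag f-numbers of the pyramid P × B₁ on nonempty words, given the flag f-numbers f of P.
pyramidF : (List AB → ℕ) → List AB → ℕ
pyramidF f [] = 0
pyramidF f (a ∷ []) = f []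
pyramidF f (a ∷ a ∷ u) = pyramidF (λ s → f (a ∷ s)) (a ∷ u)
pyramidF f (a ∷ b ∷ u) = f (b ∷ u) + isNil u * f (a ∷ []) + pyramidF (λ s → f (a ∷ b ∷ s)) u
pyramidF f (b ∷ u) = f u + isNil u * f [] + pyramidF (λ s → f (b ∷ s)) u

-- The derivation G of Ehrenborg–Readdy (G c = d, G d = cd) applied to a monomial, as a list of terms.
derivationG : List CD → List (List CD)
derivationG [] = []
derivationG (c ∷ v) = (d ∷ v) ∷ map (c ∷_) (derivationG v)
derivationG (d ∷ v) = (c ∷ d ∷ v) ∷ map (d ∷_) (derivationG v)

pyramidF-cong : ∀ {f g} → (∀ s → f s ≡ g s) → ∀ u → pyramidF f u ≡ pyramidF g u
pyramidF-cong e [] = refl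
pyramidF-cong e (a ∷ []) = e []
pyramidF-cong e (a ∷ a ∷ u) = pyramidF-cong (λ s → e (a ∷ s)) (a ∷ u)
pyramidF-cong e (a ∷ b ∷ u) =
  cong₂ _+_ (cong₂ _+_ (e (b ∷ u)) (cong (isNil u *_) (e (a ∷ [])))) (pyramidF-cong (λ s → e (a ∷ b ∷ s)) u)
pyramidF-cong e (b ∷ u) = cong₂ _+_ (cong₂ _+_ (e u) (cong (isNil u *_) (e []))) (pyramidF-cong (λ s → e (b ∷ s)) u)

pyramidF-congOnLength : ∀ {f g} u → (∀ s → suc (length s) ≡ length u → f s ≡ g s) → pyramidF f u ≡ pyramidF g u
pyramidF-congOnLength [] e = refl
pyramidF-congOnLength (a ∷ []) e = e [] refl
pyramidF-congOnLength (a ∷ a ∷ u) e = pyramidF-congOnLength (a ∷ u) (λ s p → e (a ∷ s) (cong suc p))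
pyramidF-congOnLength (a ∷ b ∷ []) e = cong₂ _+_ (cong₂ _+_ (e (b ∷ []) refl) (cong (1 *_) (e (a ∷ []) refl))) refl
pyramidF-congOnLength (a ∷ b ∷ x ∷ u) e =
  cong₂ _+_ (cong (_+ 0) (e (b ∷ x ∷ u) refl)) (pyramidF-congOnLength (x ∷ u) (λ s p → e (a ∷ b ∷ s) (cong (2 +_) p)))
pyramidF-congOnLength (b ∷ []) e = cong₂ _+_ (cong₂ _+_ (e [] refl) (cong (1 *_) (e [] refl))) refl
pyramidF-congOnLength (b ∷ x ∷ u) e =
  cong₂ _+_ (cong (_+ 0) (e (x ∷ u) refl)) (pyramidF-congOnLength (x ∷ u) (λ s p → e (b ∷ s) (cong suc p)))

private
  *-step : ∀ k x n y q → k * x + n * (k * y) + k * q ≡ k * (x + n * y + q)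
  *-step = ℕ-Solver.solve-∀

  +-step : ∀ x y n x′ y′ p q → x + y + n * (x′ + y′) + (p + q) ≡ x + n * x′ + p + (y + n * y′ + q)
  +-step = ℕ-Solver.solve-∀

pyramidF-*ˡ : ∀ k f u → pyramidF (λ s → k * f s) u ≡ k * pyramidF f u
pyramidF-*ˡ k f [] = sym (*-zeroʳ k)
pyramidF-*ˡ k f (a ∷ []) = refl
pyramidF-*ˡ k f (a ∷ a ∷ u) = pyramidF-*ˡ k (λ s → f (a ∷ s)) (a ∷ u)
pyramidF-*ˡ k f (a ∷ b ∷ u) =
  trans (cong (k * f (b ∷ u) + isNil u * (k * f (a ∷ [])) +_) (pyramidF-*ˡ k (λ s → f (a ∷ b ∷ s)) u))
        (*-step k (f (b ∷ u)) (isNil u) (f (a ∷ [])) _)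
pyramidF-*ˡ k f (b ∷ u) =
  trans (cong (k * f u + isNil u * (k * f []) +_) (pyramidF-*ˡ k (λ s → f (b ∷ s)) u)) (*-step k (f u) (isNil u) (f []) _)

pyramidF-+ : ∀ f g u → pyramidF (λ s → f s + g s) u ≡ pyramidF f u + pyramidF g u
pyramidF-+ f g [] = refl
pyramidF-+ f g (a ∷ []) = refl
pyramidF-+ f g (a ∷ a ∷ u) = pyramidF-+ (λ s → f (a ∷ s)) (λ s → g (a ∷ s)) (a ∷ u)
pyramidF-+ f g (a ∷ b ∷ u) =
  trans (cong (f (b ∷ u) + g (b ∷ u) + isNil u * (f (a ∷ []) + g (a ∷ [])) +_)
              (pyramidF-+ (λ s → f (a ∷ b ∷ s)) (λ s → g (a ∷ b ∷ s)) u))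
        (+-step (f (b ∷ u)) (g (b ∷ u)) (isNil u) (f (a ∷ [])) (g (a ∷ [])) _ _)
pyramidF-+ f g (b ∷ u) =
  trans (cong (f u + g u + isNil u * (f [] + g []) +_) (pyramidF-+ (λ s → f (b ∷ s)) (λ s → g (b ∷ s)) u))
        (+-step (f u) (g u) (isNil u) (f []) (g []) _ _)

pyramidF-zero : ∀ {f} → (∀ s → f s ≡ 0) → ∀ u → pyramidF f u ≡ 0
pyramidF-zero {f} e u = trans (pyramidF-cong {g = λ s → 0 * f s} e u) (pyramidF-*ˡ 0 f u)

pyramidF-sum : ∀ vs u → pyramidF (fExpand vs) u ≡ sumℕ (map (λ v → pyramidF (fExpandCoeff v) u) vs)
pyramidF-sum [] u = pyramidF-zero (λ _ → refl) u
pyramidF-sum (v ∷ vs) u = trans (pyramidF-+ (fExpandCoeff v) (fExpand vs) u) (cong (pyramidF (fExpandCoeff v) u +_) (pyramidF-sum vs u))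

fExpand-map-∷ : ∀ x vs u → fExpand (map (x ∷_) vs) u ≡ sumℕ (map (λ v → fExpandCoeff (x ∷ v) u) vs)
fExpand-map-∷ x vs u = sumℕ-map-∘ (λ v → fExpandCoeff v u) (x ∷_) vs

fExpand-map-∷-zero : ∀ x vs u → (∀ v → fExpandCoeff (x ∷ v) u ≡ 0) → fExpand (map (x ∷_) vs) u ≡ 0
fExpand-map-∷-zero x vs u e = trans (fExpand-map-∷ x vs u) (sumℕ-zero e vs)

fExpand-map-∷-double : ∀ x vs u u′ → (∀ v → fExpandCoeff (x ∷ v) u ≡ 2 * fExpandCoeff v u′) →
  fExpand (map (x ∷_) vs) u ≡ 2 * fExpand vs u′
fExpand-map-∷-double x vs u u′ e =
  trans (fExpand-map-∷ x vs u) (trans (sumℕ-cong e vs) (sumℕ-*ˡ 2 (λ v → fExpandCoeff v u′) vs))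

-- The pyramid formula Φ(P × B₁) = Φ(P) c + G(Φ(P)) of Ehrenborg–Readdy, for a monomial, read in the flag-f basis.
PyramidIdentity-at : List CD → List AB → Set
PyramidIdentity-at v u = fExpandCoeff (v ++ c ∷ []) u + fExpand (derivationG v) u ≡ pyramidF (fExpandCoeff v) u

PyramidIdentity : List CD → Set
PyramidIdentity v = ∀ u → PyramidIdentity-at v u

pyramidIdentity-[] : PyramidIdentity []
pyramidIdentity-[] [] = refl
pyramidIdentity-[] (a ∷ []) = refl
pyramidIdentity-[] (a ∷ a ∷ u) = sym (pyramidF-zero (λ _ → refl) (a ∷ u))
pyramidIdentity-[] (a ∷ b ∷ u) =
  sym (trans (cong (isNil u * 0 +_) (pyramidF-zero (λ _ → refl) u)) (trans (+-identityʳ _) (*-zeroʳ (isNil u))))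
pyramidIdentity-[] (b ∷ []) = refl
pyramidIdentity-[] (b ∷ x ∷ u) = sym (pyramidF-zero (λ _ → refl) (x ∷ u))

pyramidIdentity-c : ∀ {v} → PyramidIdentity v → PyramidIdentity (c ∷ v)
pyramidIdentity-c {v} IH [] = fExpand-map-∷-zero c (derivationG v) [] (λ _ → refl)
pyramidIdentity-c {v} IH (a ∷ []) =
  trans (cong (fExpandCoeff (v ++ c ∷ []) [] +_) (fExpand-map-∷ c (derivationG v) (a ∷ []))) (IH [])
pyramidIdentity-c {v} IH (a ∷ a ∷ u) =
  trans (cong (fExpandCoeff (v ++ c ∷ []) (a ∷ u) +_) (fExpand-map-∷ c (derivationG v) (a ∷ a ∷ u))) (IH (a ∷ u))
pyramidIdentity-c {v} IH (a ∷ b ∷ u) = begin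
  X + (E + fExpand (map (c ∷_) (derivationG v)) (a ∷ b ∷ u)) ≡⟨ cong (λ z → X + (E + z)) (fExpand-map-∷ c (derivationG v) (a ∷ b ∷ u)) ⟩
  X + (E + fExpand (derivationG v) (b ∷ u))                   ≡⟨ +-exchange X E _ ⟩
  E + (X + fExpand (derivationG v) (b ∷ u))                   ≡⟨ cong (E +_) (IH (b ∷ u)) ⟩
  E + (E + isNil u * fExpandCoeff v [] + pyramidF (λ t → fExpandCoeff v (b ∷ t)) u)
    ≡⟨ double E (isNil u * fExpandCoeff v []) _ ⟩
  2 * E + isNil u * fExpandCoeff v [] + pyramidF (λ t → fExpandCoeff v (b ∷ t)) u ∎
  where
  open ≡-Reasoning
  X : ℕ
  X = fExpandCoeff (v ++ c ∷ []) (b ∷ u)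
  E : ℕ
  E = fExpandCoeff v u
  double : ∀ x y z → x + (x + y + z) ≡ 2 * x + y + z
  double = ℕ-Solver.solve-∀
pyramidIdentity-c {v} IH (b ∷ u) = begin
  2 * X + (Y + fExpand (map (c ∷_) (derivationG v)) (b ∷ u))
    ≡⟨ cong₂ (λ y z → 2 * X + (y + z)) (d-b≡c u) (fExpand-map-∷-double c (derivationG v) (b ∷ u) u (λ _ → refl)) ⟩
  2 * X + (fExpandCoeff (c ∷ v) u + 2 * S) ≡⟨ regroup X (fExpandCoeff (c ∷ v) u) S ⟩
  fExpandCoeff (c ∷ v) u + 0 + 2 * (X + S) ≡⟨ cong (λ z → fExpandCoeff (c ∷ v) u + 0 + 2 * z) (IH u) ⟩
  fExpandCoeff (c ∷ v) u + 0 + 2 * pyramidF (fExpandCoeff v) u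
    ≡⟨ cong₂ (λ y z → fExpandCoeff (c ∷ v) u + y + z) (sym (*-zeroʳ (isNil u))) (sym (pyramidF-*ˡ 2 (fExpandCoeff v) u)) ⟩
  fExpandCoeff (c ∷ v) u + isNil u * 0 + pyramidF (λ t → 2 * fExpandCoeff v t) u ∎
  where
  open ≡-Reasoning
  X : ℕ
  X = fExpandCoeff (v ++ c ∷ []) u
  Y : ℕ
  Y = fExpandCoeff (d ∷ v) (b ∷ u)
  S : ℕ
  S = fExpand (derivationG v) u
  d-b≡c : ∀ u → fExpandCoeff (d ∷ v) (b ∷ u) ≡ fExpandCoeff (c ∷ v) u
  d-b≡c [] = refl
  d-b≡c (a ∷ u) = refl
  d-b≡c (b ∷ u) = refl
  regroup : ∀ x y z → 2 * x + (y + 2 * z) ≡ y + 0 + 2 * (x + z)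
  regroup = ℕ-Solver.solve-∀

pyramidIdentity-da : ∀ {v} → PyramidIdentity v → ∀ u → PyramidIdentity-at (d ∷ v) (a ∷ u)
pyramidIdentity-da {v} IH [] = fExpand-map-∷-zero d (derivationG v) (a ∷ []) (λ _ → refl)
pyramidIdentity-da {v} IH (a ∷ u) =
  trans (cong (fExpandCoeff (d ∷ v) (a ∷ u) +_) (fExpand-map-∷-zero d (derivationG v) (a ∷ a ∷ u) (λ _ → refl)))
        (trans (+-identityʳ _) (onlyLeadingTerm u))
  where
  onlyLeadingTerm : ∀ u → fExpandCoeff (d ∷ v) (a ∷ u) ≡ pyramidF (λ t → fExpandCoeff (d ∷ v) (a ∷ t)) (a ∷ u)
  onlyLeadingTerm [] = refl
  onlyLeadingTerm (a ∷ u) = sym (pyramidF-zero (λ _ → refl) (a ∷ u))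
  onlyLeadingTerm (b ∷ u) = sym (trans (cong₂ (λ y z → fExpandCoeff v u + y + z) (*-zeroʳ (isNil u)) (pyramidF-zero (λ _ → refl) u))
                             (trans (+-identityʳ _) (+-identityʳ _)))
pyramidIdentity-da {v} IH (b ∷ u) = begin
  X + (Y + fExpand (map (d ∷_) (derivationG v)) (a ∷ b ∷ u)) ≡⟨ cong (λ z → X + (Y + z)) (fExpand-map-∷ d (derivationG v) (a ∷ b ∷ u)) ⟩
  X + (Y + fExpand (derivationG v) u)                        ≡⟨ +-exchange X Y _ ⟩
  Y + (X + fExpand (derivationG v) u)                        ≡⟨ cong (Y +_) (IH u) ⟩
  Y + pyramidF (fExpandCoeff v) u                            ≡⟨ cong (λ z → z + pyramidF (fExpandCoeff v) u)
                                                                     (sym (trans (cong (Y +_) (*-zeroʳ (isNil u))) (+-identityʳ Y))) ⟩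
  Y + isNil u * 0 + pyramidF (fExpandCoeff v) u              ∎
  where
  open ≡-Reasoning
  X : ℕ
  X = fExpandCoeff (v ++ c ∷ []) u
  Y : ℕ
  Y = fExpandCoeff (d ∷ v) (b ∷ u)
pyramidIdentity-db : ∀ {v} → PyramidIdentity v → ∀ u → PyramidIdentity-at (d ∷ v) (b ∷ u)
pyramidIdentity-db {v} IH [] = fExpand-map-∷-zero d (derivationG v) (b ∷ []) (λ _ → refl)
pyramidIdentity-db {v} IH (a ∷ []) =
  trans (cong (fExpandCoeff (v ++ c ∷ []) [] +_) (fExpand-map-∷ d (derivationG v) (b ∷ a ∷ []))) (IH [])
pyramidIdentity-db {v} IH (a ∷ a ∷ u) =
  trans (cong (fExpandCoeff (v ++ c ∷ []) (a ∷ u) +_) (fExpand-map-∷ d (derivationG v) (b ∷ a ∷ a ∷ u))) (IH (a ∷ u))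
pyramidIdentity-db {v} IH (a ∷ b ∷ u) = begin
  X + (2 * E + fExpand (map (d ∷_) (derivationG v)) (b ∷ a ∷ b ∷ u)) ≡⟨ cong (λ z → X + (2 * E + z)) (fExpand-map-∷ d (derivationG v) (b ∷ a ∷ b ∷ u)) ⟩
  X + (2 * E + fExpand (derivationG v) (b ∷ u))                       ≡⟨ +-exchange X (2 * E) _ ⟩
  2 * E + (X + fExpand (derivationG v) (b ∷ u))                       ≡⟨ cong (2 * E +_) (IH (b ∷ u)) ⟩
  2 * E + (E + isNil u * fExpandCoeff v [] + pyramidF (λ t → fExpandCoeff v (b ∷ t)) u)
    ≡⟨ regroup E (isNil u * fExpandCoeff v []) _ ⟩
  E + 0 + (2 * E + isNil u * fExpandCoeff v [] + pyramidF (λ t → fExpandCoeff v (b ∷ t)) u) ∎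
  where
  open ≡-Reasoning
  X : ℕ
  X = fExpandCoeff (v ++ c ∷ []) (b ∷ u)
  E : ℕ
  E = fExpandCoeff v u
  regroup : ∀ x y z → 2 * x + (x + y + z) ≡ x + 0 + (2 * x + y + z)
  regroup = ℕ-Solver.solve-∀
pyramidIdentity-db {v} IH (b ∷ u) = begin
  2 * X + (2 * Y + fExpand (map (d ∷_) (derivationG v)) (b ∷ b ∷ u))
    ≡⟨ cong (λ z → 2 * X + (2 * Y + z)) (fExpand-map-∷-double d (derivationG v) (b ∷ b ∷ u) u (λ _ → refl)) ⟩
  2 * X + (2 * Y + 2 * fExpand (derivationG v) u) ≡⟨ regroup X Y (fExpand (derivationG v) u) ⟩
  Y + 2 * (X + fExpand (derivationG v) u) + Y     ≡⟨ cong (λ z → Y + 2 * z + Y) (IH u) ⟩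
  Y + 2 * pyramidF (fExpandCoeff v) u + Y         ≡⟨ cong (λ z → Y + z + Y) (sym (pyramidF-*ˡ 2 (fExpandCoeff v) u)) ⟩
  Y + P + Y                                       ≡⟨ regroup′ Y P ⟩
  Y + 0 + (Y + 0 + P)                             ≡⟨ cong (λ z → Y + 0 + (Y + z + P)) (sym (*-zeroʳ (isNil u))) ⟩
  Y + 0 + (Y + isNil u * fExpandCoeff (d ∷ v) (b ∷ []) + P) ∎
  where
  open ≡-Reasoning
  X : ℕ
  X = fExpandCoeff (v ++ c ∷ []) u
  Y : ℕ
  Y = fExpandCoeff (d ∷ v) (b ∷ u)
  P : ℕ
  P = pyramidF (λ t → 2 * fExpandCoeff v t) u
  regroup : ∀ x y z → 2 * x + (2 * y + 2 * z) ≡ y + 2 * (x + z) + y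
  regroup = ℕ-Solver.solve-∀
  regroup′ : ∀ y q → y + q + y ≡ y + 0 + (y + 0 + q)
  regroup′ = ℕ-Solver.solve-∀

pyramidIdentity-d : ∀ {v} → PyramidIdentity v → PyramidIdentity (d ∷ v)
pyramidIdentity-d {v} IH [] = fExpand-map-∷-zero d (derivationG v) [] (λ _ → refl)
pyramidIdentity-d IH (a ∷ u) = pyramidIdentity-da IH u
pyramidIdentity-d IH (b ∷ u) = pyramidIdentity-db IH u

pyramidIdentity : ∀ v → PyramidIdentity v
pyramidIdentity [] = pyramidIdentity-[]
pyramidIdentity (c ∷ v) = pyramidIdentity-c (pyramidIdentity v)
pyramidIdentity (d ∷ v) = pyramidIdentity-d (pyramidIdentity v)

-- Φ(B_{N+1}), of degree N, by the Ehrenborg–Readdy recursion Φ(B_{N+1}) = Φ(B_N) c + G(Φ(B_N)).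
cdIndexBoolean : ℕ → List (List CD)
cdIndexBoolean zero = [] ∷ []
cdIndexBoolean (suc N) = map (_++ c ∷ []) (cdIndexBoolean N) ++ concatMap derivationG (cdIndexBoolean N)

derivationG-degree : ∀ v → All (λ y → degCD y ≡ suc (degCD v)) (derivationG v)
derivationG-degree [] = []
derivationG-degree (c ∷ v) = refl ∷ Allₚ.gmap⁺ (cong suc) (derivationG-degree v)
derivationG-degree (d ∷ v) = refl ∷ Allₚ.gmap⁺ (cong (2 +_)) (derivationG-degree v)

cdIndexBoolean-degree : ∀ N → All (λ v → degCD v ≡ N) (cdIndexBoolean N)
cdIndexBoolean-degree zero = refl ∷ []
cdIndexBoolean-degree (suc N) =
  Allₚ.++⁺ (Allₚ.gmap⁺ (λ {v} deg → trans (degCD-∷ʳ v c) (cong suc deg)) (cdIndexBoolean-degree N))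
           (Allₚ.concat⁺ (Allₚ.gmap⁺ (λ {v} deg → All.map (λ e → trans e (cong suc deg)) (derivationG-degree v)) (cdIndexBoolean-degree N)))

fExpand-pyramid : ∀ vs u → fExpand (map (_++ c ∷ []) vs ++ concatMap derivationG vs) u ≡ pyramidF (fExpand vs) u
fExpand-pyramid vs u = begin
  fExpand (map (_++ c ∷ []) vs ++ concatMap derivationG vs) u
    ≡⟨ sumℕ-++ (λ v → fExpandCoeff v u) (map (_++ c ∷ []) vs) (concatMap derivationG vs) ⟩
  fExpand (map (_++ c ∷ []) vs) u + fExpand (concatMap derivationG vs) u
    ≡⟨ cong₂ _+_ (sumℕ-map-∘ (λ v → fExpandCoeff v u) (_++ c ∷ []) vs) (sumℕ-concatMap (λ v → fExpandCoeff v u) derivationG vs) ⟩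
  sumℕ (map (λ v → fExpandCoeff (v ++ c ∷ []) u) vs) + sumℕ (map (λ v → fExpand (derivationG v) u) vs)
    ≡⟨ sym (sumℕ-+ (λ v → fExpandCoeff (v ++ c ∷ []) u) (λ v → fExpand (derivationG v) u) vs) ⟩
  sumℕ (map (λ v → fExpandCoeff (v ++ c ∷ []) u + fExpand (derivationG v) u) vs)
    ≡⟨ sumℕ-cong (λ v → pyramidIdentity v u) vs ⟩
  sumℕ (map (λ v → pyramidF (fExpandCoeff v) u) vs)
    ≡⟨ sym (pyramidF-sum vs u) ⟩
  pyramidF (fExpand vs) u ∎
  where open ≡-Reasoning

-- Boolean algebras

-- Chains of B_M whose ranks are the b-positions of u shifted by j (j letters have passed since the
-- last element of the chain): the next element adds j + 1 atoms.
booleanFlagF : ℕ → ℕ → List AB → ℕ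
booleanFlagF M j [] = 1
booleanFlagF M j (a ∷ u) = booleanFlagF M (suc j) u
booleanFlagF M j (b ∷ u) = (M C suc j) * booleanFlagF (M ∸ suc j) 0 u

aⁿ : ℕ → List AB
aⁿ j = replicate j a

isZero : ℕ → ℕ
isZero zero = 1
isZero (suc _) = 0

leadingTerm : (List AB → ℕ) → ℕ → List AB → ℕ
leadingTerm f zero r = f r
leadingTerm f (suc j) r = f (aⁿ j ++ b ∷ r)

pyramidF-aⁿb : ∀ j f r →
  pyramidF f (aⁿ j ++ b ∷ r) ≡ leadingTerm f j r + isNil r * f (aⁿ j) + pyramidF (λ s → f (aⁿ j ++ b ∷ s)) r
pyramidF-aⁿb zero f r = refl
pyramidF-aⁿb (suc zero) f r = refl
pyramidF-aⁿb (suc (suc j)) f r = pyramidF-aⁿb (suc j) (λ s → f (a ∷ s)) r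

pyramidF-aⁿ⁺¹ : ∀ j f → pyramidF f (a ∷ aⁿ j) ≡ f (aⁿ j)
pyramidF-aⁿ⁺¹ zero f = refl
pyramidF-aⁿ⁺¹ (suc j) f = pyramidF-aⁿ⁺¹ j (λ s → f (a ∷ s))

booleanFlagF-aⁿ : ∀ M i k → booleanFlagF M i (aⁿ k) ≡ 1
booleanFlagF-aⁿ M i zero = refl
booleanFlagF-aⁿ M i (suc k) = booleanFlagF-aⁿ M (suc i) k

aⁿ-++-a : ∀ j r → aⁿ j ++ a ∷ r ≡ aⁿ (suc j) ++ r
aⁿ-++-a zero r = refl
aⁿ-++-a (suc j) r = cong (a ∷_) (aⁿ-++-a j r)

booleanFlagF-skip : ∀ M j s → booleanFlagF M 0 (aⁿ j ++ s) ≡ booleanFlagF M j s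
booleanFlagF-skip M j s = go 0 j s
  where
  go : ∀ i j s → booleanFlagF M i (aⁿ j ++ s) ≡ booleanFlagF M (i + j) s
  go i zero s = cong (λ k → booleanFlagF M k s) (sym (+-identityʳ i))
  go i (suc j) s = trans (go (suc i) j s) (cong (λ k → booleanFlagF M k s) (sym (+-suc i j)))

leadingTerm-booleanFlagF : ∀ r j →
  leadingTerm (booleanFlagF (suc (length r + j)) 0) j r ≡ (suc (length r + j) C j) * booleanFlagF (suc (length r)) 0 r
leadingTerm-booleanFlagF r zero =
  trans (cong (λ k → booleanFlagF (suc k) 0 r) (+-identityʳ (length r))) (sym (+-identityʳ _))
leadingTerm-booleanFlagF r (suc j) =
  trans (booleanFlagF-skip (suc (length r + suc j)) j (b ∷ r))
        (cong (λ k → (suc (length r + suc j) C suc j) * booleanFlagF k 0 r) (m+n∸n≡m (suc (length r)) (suc j)))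

module _ (r : List AB) (j : ℕ) where
  private
    L : ℕ
    L = length r
    M : ℕ
    M = suc (L + j)
    f : List AB → ℕ
    f = booleanFlagF M 0

  pyramidF-booleanFlagF-aⁿb : pyramidF f (aⁿ j ++ b ∷ r) ≡
    (M C j) * booleanFlagF (suc L) 0 r + isNil r + (M C suc j) * pyramidF (booleanFlagF L 0) r
  pyramidF-booleanFlagF-aⁿb = begin
    pyramidF f (aⁿ j ++ b ∷ r)
      ≡⟨ pyramidF-aⁿb j f r ⟩
    leadingTerm f j r + isNil r * f (aⁿ j) + pyramidF (λ s → f (aⁿ j ++ b ∷ s)) r
      ≡⟨ cong₂ (λ x y → x + isNil r * y + pyramidF (λ s → f (aⁿ j ++ b ∷ s)) r) (leadingTerm-booleanFlagF r j) (booleanFlagF-aⁿ M 0 j) ⟩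
    (M C j) * booleanFlagF (suc L) 0 r + isNil r * 1 + pyramidF (λ s → f (aⁿ j ++ b ∷ s)) r
      ≡⟨ cong₂ (λ x y → (M C j) * booleanFlagF (suc L) 0 r + x + y) (*-identityʳ (isNil r)) afterFirstB ⟩
    (M C j) * booleanFlagF (suc L) 0 r + isNil r + (M C suc j) * pyramidF (booleanFlagF L 0) r ∎
    where
    open ≡-Reasoning
    afterFirstB : pyramidF (λ s → f (aⁿ j ++ b ∷ s)) r ≡ (M C suc j) * pyramidF (booleanFlagF L 0) r
    afterFirstB = trans (pyramidF-cong (λ s → trans (booleanFlagF-skip M j (b ∷ s))
                                                    (cong (λ k → (M C suc j) * booleanFlagF k 0 s) (m+n∸n≡m L j))) r)
                        (pyramidF-*ˡ (M C suc j) (booleanFlagF L 0) r)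

binomial-isNil : ∀ (r : List AB) j → (suc (length r + j) C suc j) * isNil r ≡ isNil r
binomial-isNil [] j = trans (*-identityʳ _) (nCn≡1 (suc j))
binomial-isNil r@(_ ∷ _) j = *-zeroʳ (suc (length r + j) C suc j)

-- The correction term only matters for the empty word, where pyramidF is 0.
booleanFlagF-pyramid : ∀ r M j → length r + j ≡ M →
  booleanFlagF (suc M) j r ≡ pyramidF (booleanFlagF M 0) (aⁿ j ++ r) + isZero j * isNil r
booleanFlagF-pyramid [] M zero e = refl
booleanFlagF-pyramid [] M (suc j) e =
  sym (trans (+-identityʳ _) (trans (cong (λ s → pyramidF (booleanFlagF M 0) (a ∷ s)) (++-identityʳ (aⁿ j)))
                                    (trans (pyramidF-aⁿ⁺¹ j (booleanFlagF M 0)) (booleanFlagF-aⁿ M 0 j))))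
booleanFlagF-pyramid (a ∷ r) M j e = begin
  booleanFlagF (suc M) (suc j) r
    ≡⟨ booleanFlagF-pyramid r M (suc j) (trans (+-suc (length r) j) e) ⟩
  pyramidF (booleanFlagF M 0) (aⁿ (suc j) ++ r) + 0
    ≡⟨ cong₂ _+_ (cong (pyramidF (booleanFlagF M 0)) (sym (aⁿ-++-a j r))) (sym (*-zeroʳ (isZero j))) ⟩
  pyramidF (booleanFlagF M 0) (aⁿ j ++ a ∷ r) + isZero j * 0 ∎
  where open ≡-Reasoning
booleanFlagF-pyramid (b ∷ r) .(suc (length r + j)) j refl = begin
  (suc M C suc j) * booleanFlagF (suc M ∸ suc j) 0 r
    ≡⟨ cong (λ k → (suc M C suc j) * booleanFlagF k 0 r) (m+n∸n≡m (suc L) j) ⟩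
  (suc M C suc j) * B
    ≡⟨ cong (_* B) (sym (nCk+nC[k+1]≡[n+1]C[k+1] M j)) ⟩
  ((M C j) + (M C suc j)) * B
    ≡⟨ *-distribʳ-+ B (M C j) (M C suc j) ⟩
  (M C j) * B + (M C suc j) * B
    ≡⟨ cong (λ z → (M C j) * B + (M C suc j) * z) (trans (booleanFlagF-pyramid r L 0 (+-identityʳ L)) (cong (q +_) (+-identityʳ _))) ⟩
  (M C j) * B + (M C suc j) * (q + isNil r)
    ≡⟨ cong ((M C j) * B +_) (*-distribˡ-+ (M C suc j) q (isNil r)) ⟩
  (M C j) * B + ((M C suc j) * q + (M C suc j) * isNil r)
    ≡⟨ cong (λ z → (M C j) * B + ((M C suc j) * q + z)) (binomial-isNil r j) ⟩
  (M C j) * B + ((M C suc j) * q + isNil r)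
    ≡⟨ regroup ((M C j) * B) ((M C suc j) * q) (isNil r) ⟩
  (M C j) * B + isNil r + (M C suc j) * q
    ≡⟨ sym (pyramidF-booleanFlagF-aⁿb r j) ⟩
  pyramidF (booleanFlagF M 0) (aⁿ j ++ b ∷ r)
    ≡⟨ sym (trans (cong (pyramidF (booleanFlagF M 0) (aⁿ j ++ b ∷ r) +_) (*-zeroʳ (isZero j))) (+-identityʳ _)) ⟩
  pyramidF (booleanFlagF M 0) (aⁿ j ++ b ∷ r) + isZero j * 0 ∎
  where
  open ≡-Reasoning
  L : ℕ
  L = length r
  M : ℕ
  M = suc (L + j)
  B : ℕ
  B = booleanFlagF (suc L) 0 r
  q : ℕ
  q = pyramidF (booleanFlagF L 0) r
  regroup : ∀ x y z → x + (y + z) ≡ x + z + y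
  regroup = ℕ-Solver.solve-∀

fExpand-cdIndexBoolean : ∀ N u → length u ≡ N → fExpand (cdIndexBoolean N) u ≡ booleanFlagF (suc N) 0 u
fExpand-cdIndexBoolean zero [] e = refl
fExpand-cdIndexBoolean (suc N) u@(_ ∷ _) e = begin
  fExpand (cdIndexBoolean (suc N)) u             ≡⟨ fExpand-pyramid (cdIndexBoolean N) u ⟩
  pyramidF (fExpand (cdIndexBoolean N)) u        ≡⟨ pyramidF-congOnLength u (λ s p → fExpand-cdIndexBoolean N s (suc-injective (trans p e))) ⟩
  pyramidF (booleanFlagF (suc N) 0) u            ≡⟨ sym (+-identityʳ _) ⟩
  pyramidF (booleanFlagF (suc N) 0) (aⁿ 0 ++ u) + isZero 0 * isNil u ≡⟨ sym (booleanFlagF-pyramid u (suc N) 0 (trans (+-identityʳ _) e)) ⟩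
  booleanFlagF (2 + N) 0 u                       ∎
  where open ≡-Reasoning

-- Chains in the face poset of Λⁿ₀

countᵇ : {A : Set} → (A → Bool) → List A → ℕ
countᵇ p [] = 0
countᵇ p (x ∷ xs) = if p x then suc (countᵇ p xs) else countᵇ p xs

module _ {A : Set} where

  countᵇ-++ : ∀ (p : A → Bool) xs ys → countᵇ p (xs ++ ys) ≡ countᵇ p xs + countᵇ p ys
  countᵇ-++ p [] ys = refl
  countᵇ-++ p (x ∷ xs) ys with p x
  ... | true = cong suc (countᵇ-++ p xs ys)
  ... | false = countᵇ-++ p xs ys

  countᵇ-map : ∀ {B : Set} (p : B → Bool) (g : A → B) xs → countᵇ p (map g xs) ≡ countᵇ (λ y → p (g y)) xs
  countᵇ-map p g [] = refl
  countᵇ-map p g (x ∷ xs) with p (g x)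
  ... | true = cong suc (countᵇ-map p g xs)
  ... | false = countᵇ-map p g xs

  countᵇ-filterᵇ : ∀ (p q : A → Bool) xs → countᵇ p (filterᵇ q xs) ≡ countᵇ (λ y → q y ∧ p y) xs
  countᵇ-filterᵇ p q [] = refl
  countᵇ-filterᵇ p q (x ∷ xs) with q x
  ... | false = countᵇ-filterᵇ p q xs
  ... | true with p x
  ... | true = cong suc (countᵇ-filterᵇ p q xs)
  ... | false = countᵇ-filterᵇ p q xs

  countᵇ-cong : ∀ {p q : A → Bool} → (∀ y → p y ≡ q y) → ∀ xs → countᵇ p xs ≡ countᵇ q xs
  countᵇ-cong e [] = refl
  countᵇ-cong {q = q} e (x ∷ xs) rewrite e x with q x
  ... | true = cong suc (countᵇ-cong e xs)
  ... | false = countᵇ-cong e xs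

  countᵇ-false : ∀ (xs : List A) → countᵇ (λ _ → false) xs ≡ 0
  countᵇ-false [] = refl
  countᵇ-false (x ∷ xs) = countᵇ-false xs

  sumℕ-filterᵇ-const : ∀ (p : A → Bool) (h : A → ℕ) K xs →
    (∀ y → p y ≡ true → h y ≡ K) → sumℕ (map h (filterᵇ p xs)) ≡ countᵇ p xs * K
  sumℕ-filterᵇ-const p h K [] e = refl
  sumℕ-filterᵇ-const p h K (x ∷ xs) e with p x in eq
  ... | true = cong₂ _+_ (e x eq) (sumℕ-filterᵇ-const p h K xs e)
  ... | false = sumℕ-filterᵇ-const p h K xs e

≡ᵇ-true⇒≡ : ∀ {m n} → (m ≡ᵇ n) ≡ true → m ≡ n
≡ᵇ-true⇒≡ {m} {n} e = ≡ᵇ⇒≡ m n (subst T (sym e) tt)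

≡ᵇ-refl : ∀ n → (n ≡ᵇ n) ≡ true
≡ᵇ-refl zero = refl
≡ᵇ-refl (suc n) = ≡ᵇ-refl n

≡ᵇ-false : ∀ {m n} → m < n → (n ≡ᵇ m) ≡ false
≡ᵇ-false {zero} {suc n} _ = refl
≡ᵇ-false {suc m} {suc n} (s≤s p) = ≡ᵇ-false p

∧-trueˡ : ∀ {x y} → x ∧ y ≡ true → x ≡ true
∧-trueˡ {true} _ = refl

emptySubset : ∀ n → Subset n
emptySubset zero = []
emptySubset (suc n) = false ∷ emptySubset n

size-emptySubset : ∀ n → size (emptySubset n) ≡ 0
size-emptySubset zero = refl
size-emptySubset (suc n) = size-emptySubset n

emptySubset-⊆ᵇ : ∀ {n} (s : Subset n) → ⊆ᵇ (emptySubset n) s ≡ true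
emptySubset-⊆ᵇ [] = refl
emptySubset-⊆ᵇ (x ∷ s) = emptySubset-⊆ᵇ s

size≤ : ∀ {n} (s : Subset n) → size s ≤ n
size≤ [] = z≤n
size≤ (false ∷ s) = m≤n⇒m≤1+n (size≤ s)
size≤ (true ∷ s) = s≤s (size≤ s)

isSupersetOfSize : ∀ {n} → Subset n → ℕ → Subset n → Bool
isSupersetOfSize s₀ t s = ⊆ᵇ s₀ s ∧ (size s ≡ᵇ t)

countᵇ-allSubsets : ∀ n (p : Subset (suc n) → Bool) →
  countᵇ p (allSubsets (suc n)) ≡ countᵇ (λ s → p (false ∷ s)) (allSubsets n) + countᵇ (λ s → p (true ∷ s)) (allSubsets n)
countᵇ-allSubsets n p =
  trans (countᵇ-++ p (map (false ∷_) (allSubsets n)) (map (true ∷_) (allSubsets n)))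
        (cong₂ _+_ (countᵇ-map p (false ∷_) (allSubsets n)) (countᵇ-map p (true ∷_) (allSubsets n)))

countᵇ-supersets-tooSmall : ∀ n (s₀ : Subset n) t → t < size s₀ → countᵇ (isSupersetOfSize s₀ t) (allSubsets n) ≡ 0
countᵇ-supersets-tooSmall (suc n) (false ∷ s₀) zero p =
  trans (countᵇ-allSubsets n (isSupersetOfSize (false ∷ s₀) zero))
        (cong₂ _+_ (countᵇ-supersets-tooSmall n s₀ zero p)
                   (trans (countᵇ-cong (λ s → ∧-zeroʳ (⊆ᵇ s₀ s)) (allSubsets n)) (countᵇ-false (allSubsets n))))
countᵇ-supersets-tooSmall (suc n) (false ∷ s₀) (suc t) p =
  trans (countᵇ-allSubsets n (isSupersetOfSize (false ∷ s₀) (suc t)))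
        (cong₂ _+_ (countᵇ-supersets-tooSmall n s₀ (suc t) p) (countᵇ-supersets-tooSmall n s₀ t (<-trans (n<1+n t) p)))
countᵇ-supersets-tooSmall (suc n) (true ∷ s₀) zero p =
  trans (countᵇ-allSubsets n (isSupersetOfSize (true ∷ s₀) zero))
        (cong₂ _+_ (countᵇ-false (allSubsets n))
                   (trans (countᵇ-cong (λ s → ∧-zeroʳ (⊆ᵇ s₀ s)) (allSubsets n)) (countᵇ-false (allSubsets n))))
countᵇ-supersets-tooSmall (suc n) (true ∷ s₀) (suc t) (s≤s p) =
  trans (countᵇ-allSubsets n (isSupersetOfSize (true ∷ s₀) (suc t)))
        (cong₂ _+_ (countᵇ-false (allSubsets n)) (countᵇ-supersets-tooSmall n s₀ t p))

countᵇ-supersets : ∀ n (s₀ : Subset n) t → size s₀ ≤ t →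
  countᵇ (isSupersetOfSize s₀ t) (allSubsets n) ≡ (n ∸ size s₀) C (t ∸ size s₀)
countᵇ-supersets zero [] zero p = refl
countᵇ-supersets zero [] (suc t) p = refl
countᵇ-supersets (suc n) (false ∷ s₀) zero p =
  trans (countᵇ-allSubsets n (isSupersetOfSize (false ∷ s₀) zero))
        (trans (cong₂ _+_ (countᵇ-supersets n s₀ zero p)
                          (trans (countᵇ-cong (λ s → ∧-zeroʳ (⊆ᵇ s₀ s)) (allSubsets n)) (countᵇ-false (allSubsets n))))
               (trans (+-identityʳ _) (choose-zero (size s₀) p)))
  where
  choose-zero : ∀ k → k ≤ 0 → (n ∸ k) C (0 ∸ k) ≡ (suc n ∸ k) C (0 ∸ k)
  choose-zero zero z≤n = refl
countᵇ-supersets (suc n) (false ∷ s₀) (suc t) p with m≤n⇒m<n∨m≡n p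
... | inj₁ (s≤s k≤t) =
  trans (countᵇ-allSubsets n (isSupersetOfSize (false ∷ s₀) (suc t)))
        (trans (cong₂ _+_ (countᵇ-supersets n s₀ (suc t) p) (countᵇ-supersets n s₀ t k≤t))
               (trans (+-comm ((n ∸ k) C (suc t ∸ k)) _) pascal))
  where
  k : ℕ
  k = size s₀
  pascal : ((n ∸ k) C (t ∸ k)) + ((n ∸ k) C (suc t ∸ k)) ≡ (suc n ∸ k) C (suc t ∸ k)
  pascal = begin
    ((n ∸ k) C (t ∸ k)) + ((n ∸ k) C (suc t ∸ k)) ≡⟨ cong (λ z → ((n ∸ k) C (t ∸ k)) + ((n ∸ k) C z)) (+-∸-assoc 1 k≤t) ⟩
    ((n ∸ k) C (t ∸ k)) + ((n ∸ k) C suc (t ∸ k)) ≡⟨ nCk+nC[k+1]≡[n+1]C[k+1] (n ∸ k) (t ∸ k) ⟩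
    suc (n ∸ k) C suc (t ∸ k)                     ≡⟨ cong₂ _C_ (sym (+-∸-assoc 1 (size≤ s₀))) (sym (+-∸-assoc 1 k≤t)) ⟩
    (suc n ∸ k) C (suc t ∸ k)                     ∎
    where open ≡-Reasoning
... | inj₂ k≡1+t =
  trans (countᵇ-allSubsets n (isSupersetOfSize (false ∷ s₀) (suc t)))
        (trans (cong₂ _+_ (countᵇ-supersets n s₀ (suc t) p) (countᵇ-supersets-tooSmall n s₀ t (subst (t <_) (sym k≡1+t) (n<1+n t))))
               (trans (+-identityʳ _) (trans (cong ((n ∸ size s₀) C_) 1+t∸k≡0) (cong ((suc n ∸ size s₀) C_) (sym 1+t∸k≡0)))))
  where
  1+t∸k≡0 : suc t ∸ size s₀ ≡ 0
  1+t∸k≡0 = trans (cong (suc t ∸_) k≡1+t) (n∸n≡0 (suc t))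
countᵇ-supersets (suc n) (true ∷ s₀) (suc t) (s≤s p) =
  trans (countᵇ-allSubsets n (isSupersetOfSize (true ∷ s₀) (suc t)))
        (cong₂ _+_ (countᵇ-false (allSubsets n)) (countᵇ-supersets n s₀ t p))

-- Elements of rank t above an element of rank k < t: faces of σ₀ containing a given one, and τ when t = n.
Λ0-above : ℕ → ℕ → ℕ → ℕ
Λ0-above n k t = (n ∸ k) C (t ∸ k) + (if n ≡ᵇ t then 1 else 0)

Λ0-chains : ℕ → ℕ → List ℕ → ℕ
Λ0-chains n k [] = 1
Λ0-chains n k (t ∷ ts) = Λ0-above n k t * Λ0-chains n t ts

IncreasingBelow : ℕ → ℕ → List ℕ → Set
IncreasingBelow n k [] = ⊤
IncreasingBelow n k (t ∷ ts) = (k < t) × (t ≤ n) × IncreasingBelow n t ts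

aboveOfRank-test : ∀ {k t} m X → k < t → (0 <ᵇ m) ∧ ((m ≡ᵇ t) ∧ (X ∧ (k <ᵇ m))) ≡ X ∧ (m ≡ᵇ t)
aboveOfRank-test {k} {t} m X k<t with m ≡ᵇ t in eq
... | false = trans (∧-zeroʳ (0 <ᵇ m)) (sym (∧-zeroʳ X))
... | true rewrite ≡ᵇ-true⇒≡ {m} {t} eq | <ᵇ-true {0} {t} (≤-<-trans z≤n k<t) | <ᵇ-true {k} {t} k<t = refl

module _ (n′ : ℕ) where
  private
    n : ℕ
    n = suc n′
    faces : List (Subset n)
    faces = allSubsets n
    nonempty : Subset n → Bool
    nonempty s = 0 <ᵇ size s

  countᵇ-τ-top : ∀ t → t ≤ n → countᵇ (λ (y : FaceΛ n) → (rankΛ y ≡ᵇ t) ∧ true) (tau ∷ top ∷ []) ≡ (if n ≡ᵇ t then 1 else 0)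
  countᵇ-τ-top t t≤n rewrite ≡ᵇ-false (s≤s t≤n) | ∧-identityʳ (n ≡ᵇ t) with n ≡ᵇ t
  ... | true = refl
  ... | false = refl

  countᵇ-Λ0-elements : ∀ (p : FaceΛ n → Bool) → p bot ≡ false →
    countᵇ p (FinGradedPoset.elems (Λ0 n)) ≡ countᵇ (λ s → nonempty s ∧ p (cell s)) faces + countᵇ p (tau ∷ top ∷ [])
  countᵇ-Λ0-elements p p-bot rewrite p-bot =
    trans (countᵇ-++ p (map cell (filterᵇ nonempty faces)) (tau ∷ top ∷ []))
          (cong (_+ countᵇ p (tau ∷ top ∷ []))
                (trans (countᵇ-map p cell (filterᵇ nonempty faces)) (countᵇ-filterᵇ (λ s → p (cell s)) nonempty faces)))

  countᵇ-above-Λ0 : ∀ x t → rankΛ x < t → t ≤ n →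
    countᵇ (λ y → (rankΛ y ≡ᵇ t) ∧ ltΛ x y) (FinGradedPoset.elems (Λ0 n)) ≡ Λ0-above n (rankΛ x) t
  countᵇ-above-Λ0 bot (suc t′) _ t≤n = begin
    countᵇ p (FinGradedPoset.elems (Λ0 n))
      ≡⟨ countᵇ-Λ0-elements p refl ⟩
    countᵇ (λ s → nonempty s ∧ p (cell s)) faces + countᵇ p (tau ∷ top ∷ [])
      ≡⟨ cong₂ _+_ (countᵇ-cong (λ s → trans (sizeTest (size s)) (cong (_∧ (size s ≡ᵇ suc t′)) (sym (emptySubset-⊆ᵇ s)))) faces)
                   (countᵇ-τ-top (suc t′) t≤n) ⟩
    countᵇ (isSupersetOfSize (emptySubset n) (suc t′)) faces + (if n ≡ᵇ suc t′ then 1 else 0)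
      ≡⟨ cong (_+ (if n ≡ᵇ suc t′ then 1 else 0))
              (trans (countᵇ-supersets n (emptySubset n) (suc t′) (subst (_≤ suc t′) (sym (size-emptySubset n)) z≤n))
                     (cong (λ z → (n ∸ z) C (suc t′ ∸ z)) (size-emptySubset n))) ⟩
    Λ0-above n 0 (suc t′) ∎
    where
    open ≡-Reasoning
    p : FaceΛ n → Bool
    p y = (rankΛ y ≡ᵇ suc t′) ∧ ltΛ bot y
    sizeTest : ∀ m → (0 <ᵇ m) ∧ ((m ≡ᵇ suc t′) ∧ true) ≡ (m ≡ᵇ suc t′)
    sizeTest zero = refl
    sizeTest (suc m) = ∧-identityʳ (m ≡ᵇ t′)
  countᵇ-above-Λ0 (cell s₀) (suc t′) k<t t≤n = begin
    countᵇ p (FinGradedPoset.elems (Λ0 n))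
      ≡⟨ countᵇ-Λ0-elements p refl ⟩
    countᵇ (λ s → nonempty s ∧ p (cell s)) faces + countᵇ p (tau ∷ top ∷ [])
      ≡⟨ cong₂ _+_ (countᵇ-cong (λ s → aboveOfRank-test (size s) (⊆ᵇ s₀ s) k<t) faces) τ-top ⟩
    countᵇ (isSupersetOfSize s₀ (suc t′)) faces + (if n ≡ᵇ suc t′ then 1 else 0)
      ≡⟨ cong (_+ (if n ≡ᵇ suc t′ then 1 else 0)) (countᵇ-supersets n s₀ (suc t′) (<⇒≤ k<t)) ⟩
    Λ0-above n (size s₀) (suc t′) ∎
    where
    open ≡-Reasoning
    p : FaceΛ n → Bool
    p y = (rankΛ y ≡ᵇ suc t′) ∧ ltΛ (cell s₀) y
    τ-top : countᵇ p (tau ∷ top ∷ []) ≡ (if n ≡ᵇ suc t′ then 1 else 0)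
    τ-top rewrite <ᵇ-true (<-≤-trans k<t t≤n) = countᵇ-τ-top (suc t′) t≤n
  countᵇ-above-Λ0 tau t k<t t≤n = ⊥-elim (<⇒≱ k<t t≤n)
  countᵇ-above-Λ0 top t k<t t≤n = ⊥-elim (<⇒≱ k<t (≤-trans t≤n (n≤1+n n)))

  countChains-Λ0 : ∀ ts x → IncreasingBelow n (rankΛ x) ts → countChains (Λ0 n) x ts ≡ Λ0-chains n (rankΛ x) ts
  countChains-Λ0 [] x _ = refl
  countChains-Λ0 (t ∷ ts) x (k<t , t≤n , inc) = begin
    sumℕ (map (λ y → countChains (Λ0 n) y ts) (filterᵇ p (FinGradedPoset.elems (Λ0 n))))
      ≡⟨ sumℕ-filterᵇ-const p (λ y → countChains (Λ0 n) y ts) (Λ0-chains n t ts) (FinGradedPoset.elems (Λ0 n)) sameCount ⟩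
    countᵇ p (FinGradedPoset.elems (Λ0 n)) * Λ0-chains n t ts
      ≡⟨ cong (_* Λ0-chains n t ts) (countᵇ-above-Λ0 x t k<t t≤n) ⟩
    Λ0-above n (rankΛ x) t * Λ0-chains n t ts ∎
    where
    open ≡-Reasoning
    p : FaceΛ n → Bool
    p y = (rankΛ y ≡ᵇ t) ∧ ltΛ x y
    sameCount : ∀ y → p y ≡ true → countChains (Λ0 n) y ts ≡ Λ0-chains n t ts
    sameCount y e = trans (countChains-Λ0 ts y (subst (λ k → IncreasingBelow n k ts) (sym rank≡t) inc))
                          (cong (λ k → Λ0-chains n k ts) rank≡t)
      where
      rank≡t : rankΛ y ≡ t
      rank≡t = ≡ᵇ-true⇒≡ (∧-trueˡ e)

-- The coefficient of the letter x in c = a + 2b; for x = b it counts the two elements σ₀, τ of rank n in Λⁿ₀.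
cCoeff : AB → ℕ
cCoeff a = 1
cCoeff b = 2

Λ0-chains-bPositions : ∀ u′ x n k j → k + j + suc (length u′) ≡ n →
  Λ0-chains n k (bPositions (k + j) (u′ ++ x ∷ [])) ≡ booleanFlagF (n ∸ k) j u′ * cCoeff x
Λ0-chains-bPositions [] a n k j e = refl
Λ0-chains-bPositions [] b .(k + j + 1) k j refl = begin
  Λ0-above (k + j + 1) k (suc (k + j)) * 1
    ≡⟨ *-identityʳ _ ⟩
  ((k + j + 1) ∸ k) C (suc (k + j) ∸ k) + (if (k + j + 1) ≡ᵇ suc (k + j) then 1 else 0)
    ≡⟨ cong (λ m → (m ∸ k) C (suc (k + j) ∸ k) + (if m ≡ᵇ suc (k + j) then 1 else 0)) (+-comm (k + j) 1) ⟩
  (suc (k + j) ∸ k) C (suc (k + j) ∸ k) + (if suc (k + j) ≡ᵇ suc (k + j) then 1 else 0)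
    ≡⟨ cong₂ _+_ (nCn≡1 (suc (k + j) ∸ k)) (cong (λ z → if z then 1 else 0) (≡ᵇ-refl (k + j))) ⟩
  2 ∎
  where open ≡-Reasoning
Λ0-chains-bPositions (a ∷ r) x n k j e =
  trans (cong (λ z → Λ0-chains n k (bPositions z (r ++ x ∷ []))) (sym (+-suc k j)))
        (Λ0-chains-bPositions r x n k (suc j) (trans (cong (_+ suc (length r)) (+-suc k j)) (trans (sym (+-suc (k + j) (suc (length r)))) e)))
Λ0-chains-bPositions (b ∷ r) x .(k + j + suc (suc (length r))) k j refl = begin
  Λ0-above n k (suc (k + j)) * Λ0-chains n (suc (k + j)) (bPositions (suc (k + j)) (r ++ x ∷ []))
    ≡⟨ cong₂ _*_ firstStep restSteps ⟩
  ((n ∸ k) C suc j) * (booleanFlagF (n ∸ suc (k + j)) 0 r * cCoeff x)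
    ≡⟨ cong (λ m → ((n ∸ k) C suc j) * (booleanFlagF m 0 r * cCoeff x)) (sym (trans (∸-+-assoc n k (suc j)) (cong (n ∸_) (+-suc k j)))) ⟩
  ((n ∸ k) C suc j) * (booleanFlagF (n ∸ k ∸ suc j) 0 r * cCoeff x)
    ≡⟨ sym (*-assoc ((n ∸ k) C suc j) _ (cCoeff x)) ⟩
  ((n ∸ k) C suc j) * booleanFlagF (n ∸ k ∸ suc j) 0 r * cCoeff x ∎
  where
  open ≡-Reasoning
  n : ℕ
  n = k + j + suc (suc (length r))
  lt : suc (k + j) < n
  lt = subst (suc (k + j) <_) (sym (+-suc (k + j) (suc (length r))))
         (s≤s (subst (suc (k + j) ≤_) (sym (+-suc (k + j) (length r))) (s≤s (m≤m+n (k + j) (length r)))))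
  firstStep : Λ0-above n k (suc (k + j)) ≡ (n ∸ k) C suc j
  firstStep = trans (cong₂ (λ m z → (n ∸ k) C m + (if z then 1 else 0))
                           (trans (cong (_∸ k) (sym (+-suc k j))) (m+n∸m≡n k (suc j))) (≡ᵇ-false lt))
                    (+-identityʳ _)
  restSteps : Λ0-chains n (suc (k + j)) (bPositions (suc (k + j)) (r ++ x ∷ [])) ≡ booleanFlagF (n ∸ suc (k + j)) 0 r * cCoeff x
  restSteps = trans (cong (λ z → Λ0-chains n (suc (k + j)) (bPositions z (r ++ x ∷ []))) (sym (+-identityʳ (suc (k + j)))))
                    (Λ0-chains-bPositions r x n (suc (k + j)) 0
                      (trans (cong (_+ suc (length r)) (+-identityʳ (suc (k + j)))) (sym (+-suc (k + j) (suc (length r))))))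

bPositions-increasing : ∀ n p w k → k ≤ p → p + length w ≤ n → IncreasingBelow n k (bPositions p w)
bPositions-increasing n p [] k _ _ = tt
bPositions-increasing n p (a ∷ w) k k≤p le =
  bPositions-increasing n (suc p) w k (m≤n⇒m≤1+n k≤p) (subst (_≤ n) (+-suc p (length w)) le)
bPositions-increasing n p (b ∷ w) k k≤p le =
  s≤s k≤p ,
  ≤-trans (subst (suc p ≤_) (sym (+-suc p (length w))) (s≤s (m≤m+n p (length w)))) le ,
  bPositions-increasing n (suc p) w (suc p) ≤-refl (subst (_≤ n) (+-suc p (length w)) le)

flagF-Λ0 : ∀ n′ u′ x → length u′ ≡ n′ → flagF (Λ0 (suc n′)) (u′ ++ x ∷ []) ≡ booleanFlagF (suc n′) 0 u′ * cCoeff x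
flagF-Λ0 n′ u′ x e =
  trans (countChains-Λ0 n′ (bPositions 0 (u′ ++ x ∷ [])) bot
          (bPositions-increasing (suc n′) 0 (u′ ++ x ∷ []) 0 z≤n (≤-reflexive (trans (length-++ u′) (trans (+-comm _ 1) (cong suc e))))))
        (Λ0-chains-bPositions u′ x (suc n′) 0 0 (cong suc e))

fExpandCoeff-[]-∷ʳ : ∀ v → fExpandCoeff (v ++ c ∷ []) [] ≡ 0
fExpandCoeff-[]-∷ʳ [] = refl
fExpandCoeff-[]-∷ʳ (c ∷ v) = refl
fExpandCoeff-[]-∷ʳ (d ∷ v) = refl

fExpandCoeff-[]-nonempty : ∀ (u : List AB) x → fExpandCoeff [] (u ++ x ∷ []) ≡ 0
fExpandCoeff-[]-nonempty [] x = refl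
fExpandCoeff-[]-nonempty (y ∷ u) x = refl

fExpandCoeff-∷ʳ : ∀ v u x → fExpandCoeff (v ++ c ∷ []) (u ++ x ∷ []) ≡ fExpandCoeff v u * cCoeff x
fExpandCoeff-∷ʳ [] [] a = refl
fExpandCoeff-∷ʳ [] [] b = refl
fExpandCoeff-∷ʳ [] (a ∷ u) x = fExpandCoeff-[]-nonempty u x
fExpandCoeff-∷ʳ [] (b ∷ u) x = cong (2 *_) (fExpandCoeff-[]-nonempty u x)
fExpandCoeff-∷ʳ (c ∷ v) [] a = fExpandCoeff-[]-∷ʳ v
fExpandCoeff-∷ʳ (c ∷ v) [] b = cong (2 *_) (fExpandCoeff-[]-∷ʳ v)
fExpandCoeff-∷ʳ (c ∷ v) (a ∷ u) x = fExpandCoeff-∷ʳ v u x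
fExpandCoeff-∷ʳ (c ∷ v) (b ∷ u) x = trans (cong (2 *_) (fExpandCoeff-∷ʳ v u x)) (sym (*-assoc 2 (fExpandCoeff v u) (cCoeff x)))
fExpandCoeff-∷ʳ (d ∷ v) [] a = refl
fExpandCoeff-∷ʳ (d ∷ v) [] b = refl
fExpandCoeff-∷ʳ (d ∷ v) (a ∷ []) a = refl
fExpandCoeff-∷ʳ (d ∷ v) (a ∷ []) b = fExpandCoeff-[]-∷ʳ v
fExpandCoeff-∷ʳ (d ∷ v) (b ∷ []) a = fExpandCoeff-[]-∷ʳ v
fExpandCoeff-∷ʳ (d ∷ v) (b ∷ []) b = cong (2 *_) (fExpandCoeff-[]-∷ʳ v)
fExpandCoeff-∷ʳ (d ∷ v) (a ∷ a ∷ u) x = refl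
fExpandCoeff-∷ʳ (d ∷ v) (a ∷ b ∷ u) x = fExpandCoeff-∷ʳ v u x
fExpandCoeff-∷ʳ (d ∷ v) (b ∷ a ∷ u) x = fExpandCoeff-∷ʳ v u x
fExpandCoeff-∷ʳ (d ∷ v) (b ∷ b ∷ u) x = trans (cong (2 *_) (fExpandCoeff-∷ʳ v u x)) (sym (*-assoc 2 (fExpandCoeff v u) (cCoeff x)))

-- Φ(Λⁿ₀) for n = n′ + 1.
cdIndexΛ0 : ℕ → List (List CD)
cdIndexΛ0 n′ = map (_++ c ∷ []) (cdIndexBoolean n′)

cdIndexΛ0-degree : ∀ n′ → All (λ v → degCD v ≡ suc n′) (cdIndexΛ0 n′)
cdIndexΛ0-degree n′ = Allₚ.gmap⁺ (λ {v} deg → trans (degCD-∷ʳ v c) (cong suc deg)) (cdIndexBoolean-degree n′)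

fExpand-cdIndexΛ0 : ∀ n′ u → length u ≡ suc n′ → fExpand (cdIndexΛ0 n′) u ≡ flagF (Λ0 (suc n′)) u
fExpand-cdIndexΛ0 n′ u e with initLast u
fExpand-cdIndexΛ0 n′ .(u′ ++ x ∷ []) e | u′ ∷ʳ′ x = begin
  fExpand (cdIndexΛ0 n′) (u′ ++ x ∷ [])
    ≡⟨ sumℕ-map-∘ (λ v → fExpandCoeff v (u′ ++ x ∷ [])) (_++ c ∷ []) (cdIndexBoolean n′) ⟩
  sumℕ (map (λ v → fExpandCoeff (v ++ c ∷ []) (u′ ++ x ∷ [])) (cdIndexBoolean n′))
    ≡⟨ sumℕ-cong (λ v → fExpandCoeff-∷ʳ v u′ x) (cdIndexBoolean n′) ⟩
  sumℕ (map (λ v → fExpandCoeff v u′ * cCoeff x) (cdIndexBoolean n′))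
    ≡⟨ sumℕ-*ʳ (cCoeff x) (λ v → fExpandCoeff v u′) (cdIndexBoolean n′) ⟩
  fExpand (cdIndexBoolean n′) u′ * cCoeff x
    ≡⟨ cong (_* cCoeff x) (fExpand-cdIndexBoolean n′ u′ length-u′) ⟩
  booleanFlagF (suc n′) 0 u′ * cCoeff x
    ≡⟨ sym (flagF-Λ0 n′ u′ x length-u′) ⟩
  flagF (Λ0 (suc n′)) (u′ ++ x ∷ []) ∎
  where
  open ≡-Reasoning
  length-u′ : length u′ ≡ n′
  length-u′ = suc-injective (trans (trans (+-comm 1 (length u′)) (sym (length-++ u′))) e)

_≟ᶜᵈ_ : DecidableEquality CD
c ≟ᶜᵈ c = yes refl
c ≟ᶜᵈ d = no λ ()
d ≟ᶜᵈ c = no λ ()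
d ≟ᶜᵈ d = yes refl

_≟ʷ_ : DecidableEquality (List CD)
_≟ʷ_ = ≡-dec _≟ᶜᵈ_

indicator : List CD → List CD → ℕ
indicator v w = if does (v ≟ʷ w) then 1 else 0

multiplicity : List CD → List (List CD) → ℕ
multiplicity w vs = sumℕ (map (indicator w) vs)

indicator-refl : ∀ w → indicator w w ≡ 1
indicator-refl w rewrite dec-true (w ≟ʷ w) refl = refl

multiplicity-map-∷ : ∀ x w vs → multiplicity (x ∷ w) (map (x ∷_) vs) ≡ multiplicity w vs
multiplicity-map-∷ c w vs = sumℕ-map-∘ (indicator (c ∷ w)) (c ∷_) vs
multiplicity-map-∷ d w vs = sumℕ-map-∘ (indicator (d ∷ w)) (d ∷_) vs

multiplicity-map-∷ʳ : ∀ x w vs → multiplicity (w ++ x ∷ []) (map (_++ x ∷ []) vs) ≡ multiplicity w vs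
multiplicity-map-∷ʳ x w vs =
  trans (sumℕ-map-∘ (indicator (w ++ x ∷ [])) (_++ x ∷ []) vs) (sumℕ-cong same vs)
  where
  same : ∀ v → indicator (w ++ x ∷ []) (v ++ x ∷ []) ≡ indicator w v
  same v with w ≟ʷ v
  ... | yes refl = indicator-refl (w ++ x ∷ [])
  ... | no w≢v rewrite dec-false ((w ++ x ∷ []) ≟ʷ (v ++ x ∷ [])) (λ e → w≢v (∷ʳ-injectiveˡ w v e)) = refl

∷ʳc≢∷ʳd : ∀ p q → p ++ c ∷ [] ≢ q ++ d ∷ []
∷ʳc≢∷ʳd p q e with () ← ∷ʳ-injectiveʳ p q e

derivationG-c→d : ∀ q r → 1 ≤ multiplicity (q ++ d ∷ r) (derivationG (q ++ c ∷ r))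
derivationG-c→d [] r rewrite indicator-refl r = s≤s z≤n
derivationG-c→d (c ∷ q) r =
  ≤-trans (subst (1 ≤_) (sym (multiplicity-map-∷ c (q ++ d ∷ r) (derivationG (q ++ c ∷ r)))) (derivationG-c→d q r)) (m≤n+m _ _)
derivationG-c→d (d ∷ q) r =
  ≤-trans (subst (1 ≤_) (sym (multiplicity-map-∷ d (q ++ d ∷ r) (derivationG (q ++ c ∷ r)))) (derivationG-c→d q r)) (m≤n+m _ _)

derivationG-d→cd : ∀ q r → 1 ≤ multiplicity (q ++ c ∷ d ∷ r) (derivationG (q ++ d ∷ r))
derivationG-d→cd [] r rewrite indicator-refl r = s≤s z≤n
derivationG-d→cd (c ∷ q) r =
  ≤-trans (subst (1 ≤_) (sym (multiplicity-map-∷ c (q ++ c ∷ d ∷ r) (derivationG (q ++ d ∷ r)))) (derivationG-d→cd q r)) (m≤n+m _ _)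
derivationG-d→cd (d ∷ q) r =
  ≤-trans (subst (1 ≤_) (sym (multiplicity-map-∷ d (q ++ c ∷ d ∷ r) (derivationG (q ++ d ∷ r)))) (derivationG-d→cd q r)) (m≤n+m _ _)

multiplicity-derivationG-twoSources : ∀ w u₁ u₂ → u₁ ≢ u₂ →
  1 ≤ multiplicity w (derivationG u₁) → 1 ≤ multiplicity w (derivationG u₂) →
  ∀ vs → multiplicity u₁ vs + multiplicity u₂ vs ≤ multiplicity w (concatMap derivationG vs)
multiplicity-derivationG-twoSources w u₁ u₂ u₁≢u₂ G₁ G₂ [] = z≤n
multiplicity-derivationG-twoSources w u₁ u₂ u₁≢u₂ G₁ G₂ (v ∷ vs) =
  subst₂ _≤_ (+-interchange (indicator u₁ v) (indicator u₂ v) (multiplicity u₁ vs) (multiplicity u₂ vs))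
             (sym (sumℕ-++ (indicator w) (derivationG v) (concatMap derivationG vs)))
             (+-mono-≤ fromV (multiplicity-derivationG-twoSources w u₁ u₂ u₁≢u₂ G₁ G₂ vs))
  where
  fromV : indicator u₁ v + indicator u₂ v ≤ multiplicity w (derivationG v)
  fromV with u₁ ≟ʷ v | u₂ ≟ʷ v
  ... | yes refl | yes refl = ⊥-elim (u₁≢u₂ refl)
  ... | yes refl | no _ = G₁
  ... | no _ | yes refl = G₂
  ... | no _ | no _ = z≤n

cⁿ : ℕ → List CD
cⁿ j = replicate j c

degCD-cⁿ : ∀ j → degCD (cⁿ j) ≡ j
degCD-cⁿ zero = refl
degCD-cⁿ (suc j) = cong suc (degCD-cⁿ j)

countD-cⁿ : ∀ j → countD (cⁿ j) ≡ 0
countD-cⁿ zero = refl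
countD-cⁿ (suc j) = countD-cⁿ j

cⁿ-++ : ∀ j (r : List CD) → cⁿ (suc j) ++ r ≡ cⁿ j ++ c ∷ r
cⁿ-++ zero r = refl
cⁿ-++ (suc j) r = cong (c ∷_) (cⁿ-++ j r)

hasD-or-cⁿ : ∀ w → (∃[ p ] ∃[ s ] w ≡ p ++ d ∷ s) ⊎ w ≡ cⁿ (degCD w)
hasD-or-cⁿ [] = inj₂ refl
hasD-or-cⁿ (c ∷ w) with hasD-or-cⁿ w
... | inj₁ (p , s , e) = inj₁ (c ∷ p , s , cong (c ∷_) e)
... | inj₂ e = inj₂ (cong (c ∷_) e)
hasD-or-cⁿ (d ∷ w) = inj₁ ([] , w , refl)

multiplicity-cdIndexBoolean-suc : ∀ w N → multiplicity w (cdIndexBoolean (suc N)) ≡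
  multiplicity w (map (_++ c ∷ []) (cdIndexBoolean N)) + multiplicity w (concatMap derivationG (cdIndexBoolean N))
multiplicity-cdIndexBoolean-suc w N = sumℕ-++ (indicator w) (map (_++ c ∷ []) (cdIndexBoolean N)) (concatMap derivationG (cdIndexBoolean N))

LowerBound : ℕ → Set
LowerBound N = ∀ w → degCD w ≡ N → 2 ^ countD w ≤ multiplicity w (cdIndexBoolean N)

lowerBound-3 : LowerBound 3
lowerBound-3 (c ∷ c ∷ c ∷ []) _ = s≤s z≤n
lowerBound-3 (c ∷ d ∷ []) _ = s≤s (s≤s z≤n)
lowerBound-3 (d ∷ c ∷ []) _ = s≤s (s≤s z≤n)
lowerBound-3 [] ()
lowerBound-3 (c ∷ []) ()
lowerBound-3 (c ∷ c ∷ []) ()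
lowerBound-3 (d ∷ []) ()
lowerBound-3 (c ∷ c ∷ c ∷ c ∷ _) ()
lowerBound-3 (c ∷ c ∷ c ∷ d ∷ _) ()
lowerBound-3 (c ∷ c ∷ d ∷ _) ()
lowerBound-3 (c ∷ d ∷ c ∷ _) ()
lowerBound-3 (c ∷ d ∷ d ∷ _) ()
lowerBound-3 (d ∷ c ∷ c ∷ _) ()
lowerBound-3 (d ∷ c ∷ d ∷ _) ()
lowerBound-3 (d ∷ d ∷ _) ()

lowerBound-∷ʳc : ∀ {N} → LowerBound N → ∀ w → degCD w ≡ N →
  2 ^ countD (w ++ c ∷ []) ≤ multiplicity (w ++ c ∷ []) (cdIndexBoolean (suc N))
lowerBound-∷ʳc {N} IH w deg = begin
  2 ^ countD (w ++ c ∷ [])                                          ≡⟨ cong (2 ^_) (countD-∷ʳ w c) ⟩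
  2 ^ countD w                                                      ≤⟨ IH w deg ⟩
  multiplicity w (cdIndexBoolean N)                                 ≡⟨ sym (multiplicity-map-∷ʳ c w (cdIndexBoolean N)) ⟩
  multiplicity (w ++ c ∷ []) (map (_++ c ∷ []) (cdIndexBoolean N))  ≤⟨ m≤m+n _ _ ⟩
  _                                                                 ≡⟨ sym (multiplicity-cdIndexBoolean-suc (w ++ c ∷ []) N) ⟩
  multiplicity (w ++ c ∷ []) (cdIndexBoolean (suc N))               ∎
  where open ≤-Reasoning

multiplicity-∷ʳd-twoSources : ∀ N w u₁ u₂ → u₁ ≢ u₂ →
  1 ≤ multiplicity w (derivationG u₁) → 1 ≤ multiplicity w (derivationG u₂) →
  multiplicity u₁ (cdIndexBoolean N) + multiplicity u₂ (cdIndexBoolean N) ≤ multiplicity w (cdIndexBoolean (suc N))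
multiplicity-∷ʳd-twoSources N w u₁ u₂ u₁≢u₂ G₁ G₂ =
  ≤-trans (multiplicity-derivationG-twoSources w u₁ u₂ u₁≢u₂ G₁ G₂ (cdIndexBoolean N))
          (≤-trans (m≤n+m _ _) (≤-reflexive (sym (multiplicity-cdIndexBoolean-suc w N))))

lowerBound-cⁿd : ∀ k → LowerBound (3 + k) → 2 ^ countD (cⁿ (2 + k) ++ d ∷ []) ≤ multiplicity (cⁿ (2 + k) ++ d ∷ []) (cdIndexBoolean (4 + k))
lowerBound-cⁿd k IH = begin
  2 ^ countD w                        ≡⟨ cong (2 ^_) countD-w ⟩
  2                                   ≤⟨ n≤1+n 2 ⟩
  1 + 2                               ≤⟨ +-mono-≤ bound₁ bound₂ ⟩
  multiplicity u₁ (cdIndexBoolean (3 + k)) + multiplicity u₂ (cdIndexBoolean (3 + k))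
    ≤⟨ multiplicity-∷ʳd-twoSources (3 + k) w u₁ u₂ (∷ʳc≢∷ʳd (cⁿ (2 + k)) (cⁿ (1 + k))) (derivationG-c→d (cⁿ (2 + k)) [])
         (subst (λ v → 1 ≤ multiplicity v (derivationG u₂)) (sym (cⁿ-++ (1 + k) (d ∷ []))) (derivationG-d→cd (cⁿ (1 + k)) [])) ⟩
  multiplicity w (cdIndexBoolean (4 + k)) ∎
  where
  open ≤-Reasoning
  w : List CD
  w = cⁿ (2 + k) ++ d ∷ []
  u₁ : List CD
  u₁ = cⁿ (2 + k) ++ c ∷ []
  u₂ : List CD
  u₂ = cⁿ (1 + k) ++ d ∷ []
  countD-w : countD w ≡ 1
  countD-w = trans (countD-∷ʳ (cⁿ (2 + k)) d) (cong suc (countD-cⁿ (2 + k)))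
  bound₁ : 1 ≤ multiplicity u₁ (cdIndexBoolean (3 + k))
  bound₁ = subst (_≤ multiplicity u₁ (cdIndexBoolean (3 + k))) (cong (2 ^_) (trans (countD-∷ʳ (cⁿ (2 + k)) c) (countD-cⁿ (2 + k))))
                 (IH u₁ (trans (degCD-∷ʳ (cⁿ (2 + k)) c) (cong suc (degCD-cⁿ (2 + k)))))
  bound₂ : 2 ≤ multiplicity u₂ (cdIndexBoolean (3 + k))
  bound₂ = subst (_≤ multiplicity u₂ (cdIndexBoolean (3 + k))) (cong (2 ^_) (trans (countD-∷ʳ (cⁿ (1 + k)) d) (cong suc (countD-cⁿ (1 + k)))))
                 (IH u₂ (trans (degCD-∷ʳ (cⁿ (1 + k)) d) (cong (2 +_) (degCD-cⁿ (1 + k)))))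

-- Both w′c and the word obtained from w′ by turning one d into c are sent to w′d by G.
lowerBound-∷ʳd : ∀ k → LowerBound (3 + k) → ∀ p s → degCD (p ++ d ∷ s) ≡ 2 + k →
  2 ^ countD ((p ++ d ∷ s) ++ d ∷ []) ≤ multiplicity ((p ++ d ∷ s) ++ d ∷ []) (cdIndexBoolean (4 + k))
lowerBound-∷ʳd k IH p s deg = begin
  2 ^ countD w                        ≡⟨ cong (2 ^_) (countD-∷ʳ w′ d) ⟩
  2 ^ m + (2 ^ m + 0)                 ≡⟨ cong (2 ^ m +_) (+-identityʳ _) ⟩
  2 ^ m + 2 ^ m                       ≤⟨ +-mono-≤ bound₁ bound₂ ⟩
  multiplicity u₁ (cdIndexBoolean (3 + k)) + multiplicity u₂ (cdIndexBoolean (3 + k))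
    ≤⟨ multiplicity-∷ʳd-twoSources (3 + k) w u₁ u₂ (∷ʳc≢∷ʳd w′ (p ++ c ∷ s)) (derivationG-c→d w′ []) G₂ ⟩
  multiplicity w (cdIndexBoolean (4 + k)) ∎
  where
  open ≤-Reasoning
  w′ : List CD
  w′ = p ++ d ∷ s
  w : List CD
  w = w′ ++ d ∷ []
  u₁ : List CD
  u₁ = w′ ++ c ∷ []
  u₂ : List CD
  u₂ = (p ++ c ∷ s) ++ d ∷ []
  m : ℕ
  m = countD w′
  G₂ : 1 ≤ multiplicity w (derivationG u₂)
  G₂ = subst₂ (λ v v′ → 1 ≤ multiplicity v (derivationG v′)) (sym (++-assoc p (d ∷ s) (d ∷ []))) (sym (++-assoc p (c ∷ s) (d ∷ [])))
              (derivationG-c→d p (s ++ d ∷ []))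
  bound₁ : 2 ^ m ≤ multiplicity u₁ (cdIndexBoolean (3 + k))
  bound₁ = subst (_≤ multiplicity u₁ (cdIndexBoolean (3 + k))) (cong (2 ^_) (countD-∷ʳ w′ c))
                 (IH u₁ (trans (degCD-∷ʳ w′ c) (cong suc deg)))
  countD-u₂ : countD u₂ ≡ m
  countD-u₂ = trans (countD-∷ʳ (p ++ c ∷ s) d) (countD-d→c p s)
  degCD-u₂ : degCD u₂ ≡ 3 + k
  degCD-u₂ = trans (degCD-∷ʳ (p ++ c ∷ s) d) (cong suc (trans (degCD-d→c p s) deg))
  bound₂ : 2 ^ m ≤ multiplicity u₂ (cdIndexBoolean (3 + k))
  bound₂ = subst (_≤ multiplicity u₂ (cdIndexBoolean (3 + k))) (cong (2 ^_) countD-u₂) (IH u₂ degCD-u₂)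

cdIndexBoolean-lowerBound : ∀ k → LowerBound (3 + k)
cdIndexBoolean-lowerBound zero = lowerBound-3
cdIndexBoolean-lowerBound (suc k) w = byLastLetter (initLast w)
  where
  IH : LowerBound (3 + k)
  IH = cdIndexBoolean-lowerBound k
  byLastLetter : ∀ {w} → InitLast w → degCD w ≡ 4 + k → 2 ^ countD w ≤ multiplicity w (cdIndexBoolean (4 + k))
  byLastLetter (w′ ∷ʳ′ c) deg = lowerBound-∷ʳc IH w′ (suc-injective (trans (sym (degCD-∷ʳ w′ c)) deg))
  byLastLetter (w′ ∷ʳ′ d) deg with hasD-or-cⁿ w′
  ... | inj₁ (p , s , refl) = lowerBound-∷ʳd k IH p s (suc-injective (suc-injective (trans (sym (degCD-∷ʳ w′ d)) deg)))
  ... | inj₂ w′≡cⁿ = subst (λ v → 2 ^ countD (v ++ d ∷ []) ≤ multiplicity (v ++ d ∷ []) (cdIndexBoolean (4 + k)))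
                           (sym (trans w′≡cⁿ (cong cⁿ (suc-injective (suc-injective (trans (sym (degCD-∷ʳ w′ d)) deg))))))
                           (lowerBound-cⁿd k IH)

-- From flag f-numbers to flag h-numbers

open import Data.Integer using (ℤ; +_; 0ℤ; -1ℤ; +≤+) renaming (_+_ to _+ℤ_; _-_ to _-ℤ_; _*_ to _*ℤ_; -_ to -ℤ_; _^_ to _^ℤ_; _≤_ to _≤ℤ_)
import Data.Integer.Properties as ℤ
import Data.Integer.Tactic.RingSolver as ℤ-Solver
open import Algebra.Properties.CommutativeSemigroup ℤ.+-commutativeSemigroup using () renaming (interchange to +ℤ-interchange)

module _ {A : Set} where

  sumℤ-cong : ∀ {f g : A → ℤ} → (∀ x → f x ≡ g x) → ∀ xs → sumℤ (map f xs) ≡ sumℤ (map g xs)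
  sumℤ-cong e [] = refl
  sumℤ-cong e (x ∷ xs) = cong₂ _+ℤ_ (e x) (sumℤ-cong e xs)

  sumℤ-congOn : ∀ {P : A → Set} {f g : A → ℤ} → (∀ x → P x → f x ≡ g x) → ∀ {xs} → All P xs → sumℤ (map f xs) ≡ sumℤ (map g xs)
  sumℤ-congOn e [] = refl
  sumℤ-congOn e (px ∷ pxs) = cong₂ _+ℤ_ (e _ px) (sumℤ-congOn e pxs)

  sumℤ-map-∘ : ∀ {B : Set} (f : B → ℤ) (g : A → B) xs → sumℤ (map f (map g xs)) ≡ sumℤ (map (λ x → f (g x)) xs)
  sumℤ-map-∘ f g xs = cong sumℤ (sym (map-∘ xs))

  sumℤ-++ : ∀ (f : A → ℤ) xs ys → sumℤ (map f (xs ++ ys)) ≡ sumℤ (map f xs) +ℤ sumℤ (map f ys)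
  sumℤ-++ f [] ys = sym (ℤ.+-identityˡ _)
  sumℤ-++ f (x ∷ xs) ys = trans (cong (f x +ℤ_) (sumℤ-++ f xs ys)) (sym (ℤ.+-assoc (f x) _ _))

  sumℤ-neg : ∀ (f : A → ℤ) xs → sumℤ (map (λ x → -ℤ f x) xs) ≡ -ℤ sumℤ (map f xs)
  sumℤ-neg f [] = refl
  sumℤ-neg f (x ∷ xs) = trans (cong (-ℤ f x +ℤ_) (sumℤ-neg f xs)) (sym (ℤ.neg-distrib-+ (f x) _))

  sumℤ-+ : ∀ (f g : A → ℤ) xs → sumℤ (map (λ x → f x +ℤ g x) xs) ≡ sumℤ (map f xs) +ℤ sumℤ (map g xs)
  sumℤ-+ f g [] = refl
  sumℤ-+ f g (x ∷ xs) = trans (cong (f x +ℤ g x +ℤ_) (sumℤ-+ f g xs)) (+ℤ-interchange (f x) (g x) _ _)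

  sumℤ-*ˡ : ∀ k (f : A → ℤ) xs → sumℤ (map (λ x → k *ℤ f x) xs) ≡ k *ℤ sumℤ (map f xs)
  sumℤ-*ˡ k f [] = sym (ℤ.*-zeroʳ k)
  sumℤ-*ˡ k f (x ∷ xs) = trans (cong (k *ℤ f x +ℤ_) (sumℤ-*ˡ k f xs)) (sym (ℤ.*-distribˡ-+ k (f x) _))

  sumℤ-zero : ∀ {f : A → ℤ} → (∀ x → f x ≡ 0ℤ) → ∀ xs → sumℤ (map f xs) ≡ 0ℤ
  sumℤ-zero e [] = refl
  sumℤ-zero e (x ∷ xs) = cong₂ _+ℤ_ (e x) (sumℤ-zero e xs)

length-bPositions : ∀ k k′ (w : List AB) → length (bPositions k w) ≡ length (bPositions k′ w)
length-bPositions k k′ [] = refl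
length-bPositions k k′ (a ∷ w) = length-bPositions (suc k) (suc k′) w
length-bPositions k k′ (b ∷ w) = cong suc (length-bPositions (suc k) (suc k′) w)

countB-a : ∀ w → countB (a ∷ w) ≡ countB w
countB-a w = length-bPositions 1 0 w

countB-b : ∀ w → countB (b ∷ w) ≡ suc (countB w)
countB-b w = cong suc (length-bPositions 1 0 w)

subWords-countB : ∀ u → All (λ w → countB w ≤ countB u) (subWords u)
subWords-countB [] = z≤n ∷ []
subWords-countB (a ∷ u) =
  Allₚ.gmap⁺ (λ {w} p → subst₂ _≤_ (sym (countB-a w)) (sym (countB-a u)) p) (subWords-countB u)
subWords-countB (b ∷ u) =
  Allₚ.++⁺ (Allₚ.gmap⁺ (λ {w} p → subst₂ _≤_ (sym (countB-a w)) (sym (countB-b u)) (m≤n⇒m≤1+n p)) (subWords-countB u))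
           (Allₚ.gmap⁺ (λ {w} p → subst₂ _≤_ (sym (countB-b w)) (sym (countB-b u)) (s≤s p)) (subWords-countB u))

subWords-length : ∀ u → All (λ w → length w ≡ length u) (subWords u)
subWords-length [] = refl ∷ []
subWords-length (a ∷ u) = Allₚ.gmap⁺ (cong suc) (subWords-length u)
subWords-length (b ∷ u) = Allₚ.++⁺ (Allₚ.gmap⁺ (cong suc) (subWords-length u)) (Allₚ.gmap⁺ (cong suc) (subWords-length u))

sign : ℕ → ℤ
sign k = -1ℤ ^ℤ k

-- flagH P u is fToH (+_ ∘ flagF P) u.
fToH : (List AB → ℤ) → List AB → ℤ
fToH g u = sumℤ (map (λ w → sign (countB u ∸ countB w) *ℤ g w) (subWords u))

fToH-a : ∀ g u → fToH g (a ∷ u) ≡ fToH (λ w → g (a ∷ w)) u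
fToH-a g u =
  trans (sumℤ-map-∘ (λ w → sign (countB (a ∷ u) ∸ countB w) *ℤ g w) (a ∷_) (subWords u))
        (sumℤ-cong (λ w → cong (λ k → sign k *ℤ g (a ∷ w)) (cong₂ _∸_ (countB-a u) (countB-a w))) (subWords u))

fToH-b : ∀ g u → fToH g (b ∷ u) ≡ -ℤ fToH (λ w → g (a ∷ w)) u +ℤ fToH (λ w → g (b ∷ w)) u
fToH-b g u = begin
  sumℤ (map F (map (a ∷_) (subWords u) ++ map (b ∷_) (subWords u)))
    ≡⟨ sumℤ-++ F (map (a ∷_) (subWords u)) (map (b ∷_) (subWords u)) ⟩
  sumℤ (map F (map (a ∷_) (subWords u))) +ℤ sumℤ (map F (map (b ∷_) (subWords u)))
    ≡⟨ cong₂ _+ℤ_ (sumℤ-map-∘ F (a ∷_) (subWords u)) (sumℤ-map-∘ F (b ∷_) (subWords u)) ⟩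
  sumℤ (map (λ w → F (a ∷ w)) (subWords u)) +ℤ sumℤ (map (λ w → F (b ∷ w)) (subWords u))
    ≡⟨ cong₂ _+ℤ_ (trans (sumℤ-congOn signFlip (subWords-countB u)) (sumℤ-neg (λ w → sign (countB u ∸ countB w) *ℤ g (a ∷ w)) (subWords u)))
                  (sumℤ-cong (λ w → cong (λ k → sign k *ℤ g (b ∷ w)) (cong₂ _∸_ (countB-b u) (countB-b w))) (subWords u)) ⟩
  -ℤ fToH (λ w → g (a ∷ w)) u +ℤ fToH (λ w → g (b ∷ w)) u ∎
  where
  open ≡-Reasoning
  F : List AB → ℤ
  F w = sign (countB (b ∷ u) ∸ countB w) *ℤ g w
  signFlip : ∀ w → countB w ≤ countB u → F (a ∷ w) ≡ -ℤ (sign (countB u ∸ countB w) *ℤ g (a ∷ w))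
  signFlip w le = trans (cong (λ k → sign k *ℤ g (a ∷ w)) (trans (cong₂ _∸_ (countB-b u) (countB-a w)) (+-∸-assoc 1 le)))
                        (-1*-assoc (sign (countB u ∸ countB w)) (g (a ∷ w)))
    where
    -1*-assoc : ∀ x y → -1ℤ *ℤ x *ℤ y ≡ -ℤ (x *ℤ y)
    -1*-assoc = ℤ-Solver.solve-∀

fToH-cong : ∀ {g h} → (∀ w → g w ≡ h w) → ∀ u → fToH g u ≡ fToH h u
fToH-cong e u = sumℤ-cong (λ w → cong (sign (countB u ∸ countB w) *ℤ_) (e w)) (subWords u)

fToH-congOnLength : ∀ {g h} u → (∀ w → length w ≡ length u → g w ≡ h w) → fToH g u ≡ fToH h u
fToH-congOnLength u e = sumℤ-congOn (λ w p → cong (sign (countB u ∸ countB w) *ℤ_) (e w p)) (subWords-length u)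

fToH-zero : ∀ {g} → (∀ w → g w ≡ 0ℤ) → ∀ u → fToH g u ≡ 0ℤ
fToH-zero e u = sumℤ-zero (λ w → trans (cong (sign (countB u ∸ countB w) *ℤ_) (e w)) (ℤ.*-zeroʳ (sign (countB u ∸ countB w)))) (subWords u)

fToH-*ˡ : ∀ k g u → fToH (λ w → k *ℤ g w) u ≡ k *ℤ fToH g u
fToH-*ˡ k g u = trans (sumℤ-cong (λ w → exchange (sign (countB u ∸ countB w)) k (g w)) (subWords u))
                      (sumℤ-*ˡ k (λ w → sign (countB u ∸ countB w) *ℤ g w) (subWords u))
  where
  exchange : ∀ s k x → s *ℤ (k *ℤ x) ≡ k *ℤ (s *ℤ x)
  exchange = ℤ-Solver.solve-∀

fToH-+ : ∀ g h u → fToH (λ w → g w +ℤ h w) u ≡ fToH g u +ℤ fToH h u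
fToH-+ g h u = trans (sumℤ-cong (λ w → ℤ.*-distribˡ-+ (sign (countB u ∸ countB w)) (g w) (h w)) (subWords u))
                     (sumℤ-+ (λ w → sign (countB u ∸ countB w) *ℤ g w) (λ w → sign (countB u ∸ countB w) *ℤ h w) (subWords u))

fToH-2* : ∀ (f : List AB → ℕ) u → fToH (λ w → + (2 * f w)) u ≡ + 2 *ℤ fToH (λ w → + f w) u
fToH-2* f u = trans (fToH-cong {h = λ w → + 2 *ℤ + f w} (λ w → ℤ.pos-* 2 (f w)) u) (fToH-*ˡ (+ 2) (λ w → + f w) u)

FToHIdentity : List CD → Set
FToHIdentity v = ∀ u → + expandCoeff v u ≡ fToH (λ w → + fExpandCoeff v w) u

fToHIdentity-[] : FToHIdentity []
fToHIdentity-[] [] = refl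
fToHIdentity-[] (a ∷ u) = sym (trans (fToH-a _ u) (fToH-zero (λ _ → refl) u))
fToHIdentity-[] (b ∷ u) = sym (trans (fToH-b _ u) (cong₂ (λ x y → -ℤ x +ℤ y) (fToH-zero (λ _ → refl) u) (fToH-zero (λ _ → refl) u)))

fToHIdentity-c : ∀ {v} → FToHIdentity v → FToHIdentity (c ∷ v)
fToHIdentity-c IH [] = refl
fToHIdentity-c IH (a ∷ u) = trans (IH u) (sym (fToH-a _ u))
fToHIdentity-c {v} IH (b ∷ u) = sym (begin
  fToH (λ w → + fExpandCoeff (c ∷ v) w) (b ∷ u)          ≡⟨ fToH-b _ u ⟩
  -ℤ X +ℤ fToH (λ w → + (2 * fExpandCoeff v w)) u        ≡⟨ cong (-ℤ X +ℤ_) (fToH-2* (fExpandCoeff v) u) ⟩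
  -ℤ X +ℤ + 2 *ℤ X                                       ≡⟨ -x+2x≡x X ⟩
  X                                                      ≡⟨ sym (IH u) ⟩
  + expandCoeff v u                                      ∎)
  where
  open ≡-Reasoning
  X : ℤ
  X = fToH (λ w → + fExpandCoeff v w) u
  -x+2x≡x : ∀ x → -ℤ x +ℤ + 2 *ℤ x ≡ x
  -x+2x≡x = ℤ-Solver.solve-∀

fToHIdentity-d : ∀ {v} → FToHIdentity v → FToHIdentity (d ∷ v)
fToHIdentity-d IH [] = refl
fToHIdentity-d IH (a ∷ []) = refl
fToHIdentity-d IH (b ∷ []) = refl
fToHIdentity-d IH (a ∷ a ∷ u) = sym (trans (fToH-a _ (a ∷ u)) (trans (fToH-a _ u) (fToH-zero (λ _ → refl) u)))
fToHIdentity-d {v} IH (a ∷ b ∷ u) = sym (begin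
  fToH (λ w → + fExpandCoeff (d ∷ v) w) (a ∷ b ∷ u)      ≡⟨ trans (fToH-a _ (b ∷ u)) (fToH-b _ u) ⟩
  -ℤ fToH (λ _ → 0ℤ) u +ℤ X                             ≡⟨ cong (λ z → -ℤ z +ℤ X) (fToH-zero (λ _ → refl) u) ⟩
  0ℤ +ℤ X                                                ≡⟨ ℤ.+-identityˡ X ⟩
  X                                                      ≡⟨ sym (IH u) ⟩
  + expandCoeff v u                                      ∎)
  where
  open ≡-Reasoning
  X : ℤ
  X = fToH (λ w → + fExpandCoeff v w) u
fToHIdentity-d {v} IH (b ∷ a ∷ u) = sym (begin
  fToH (λ w → + fExpandCoeff (d ∷ v) w) (b ∷ a ∷ u)      ≡⟨ fToH-b _ (a ∷ u) ⟩
  -ℤ fToH (λ w → + fExpandCoeff (d ∷ v) (a ∷ w)) (a ∷ u) +ℤ fToH (λ w → + fExpandCoeff (d ∷ v) (b ∷ w)) (a ∷ u)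
    ≡⟨ cong₂ (λ x y → -ℤ x +ℤ y) (trans (fToH-a _ u) (fToH-zero (λ _ → refl) u)) (fToH-a _ u) ⟩
  0ℤ +ℤ X                                                ≡⟨ ℤ.+-identityˡ X ⟩
  X                                                      ≡⟨ sym (IH u) ⟩
  + expandCoeff v u                                      ∎)
  where
  open ≡-Reasoning
  X : ℤ
  X = fToH (λ w → + fExpandCoeff v w) u
fToHIdentity-d {v} IH (b ∷ b ∷ u) = sym (begin
  fToH (λ w → + fExpandCoeff (d ∷ v) w) (b ∷ b ∷ u)      ≡⟨ fToH-b _ (b ∷ u) ⟩
  -ℤ fToH (λ w → + fExpandCoeff (d ∷ v) (a ∷ w)) (b ∷ u) +ℤ fToH (λ w → + fExpandCoeff (d ∷ v) (b ∷ w)) (b ∷ u)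
    ≡⟨ cong₂ (λ x y → -ℤ x +ℤ y) (fToH-b _ u) (fToH-b _ u) ⟩
  -ℤ (-ℤ fToH (λ _ → 0ℤ) u +ℤ X) +ℤ (-ℤ X +ℤ fToH (λ w → + (2 * fExpandCoeff v w)) u)
    ≡⟨ cong₂ (λ p q → -ℤ (-ℤ p +ℤ X) +ℤ (-ℤ X +ℤ q)) (fToH-zero (λ _ → refl) u) (fToH-2* (fExpandCoeff v) u) ⟩
  -ℤ (-ℤ 0ℤ +ℤ X) +ℤ (-ℤ X +ℤ + 2 *ℤ X)                 ≡⟨ cancel X ⟩
  0ℤ                                                     ∎)
  where
  open ≡-Reasoning
  X : ℤ
  X = fToH (λ w → + fExpandCoeff v w) u
  cancel : ∀ x → -ℤ (-ℤ 0ℤ +ℤ x) +ℤ (-ℤ x +ℤ + 2 *ℤ x) ≡ 0ℤ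
  cancel = ℤ-Solver.solve-∀

fToHIdentity : ∀ v → FToHIdentity v
fToHIdentity [] = fToHIdentity-[]
fToHIdentity (c ∷ v) = fToHIdentity-c (fToHIdentity v)
fToHIdentity (d ∷ v) = fToHIdentity-d (fToHIdentity v)

fToH-fExpand : ∀ vs u → fToH (λ w → + fExpand vs w) u ≡ sumℤ (map (λ v → fToH (λ w → + fExpandCoeff v w) u) vs)
fToH-fExpand [] u = fToH-zero (λ _ → refl) u
fToH-fExpand (v ∷ vs) u =
  trans (fToH-cong (λ w → ℤ.pos-+ (fExpandCoeff v w) (fExpand vs w)) u)
        (trans (fToH-+ (λ w → + fExpandCoeff v w) (λ w → + fExpand vs w) u) (cong (fToH (λ w → + fExpandCoeff v w) u +ℤ_) (fToH-fExpand vs u)))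

flagH-Λ0 : ∀ n′ u → length u ≡ suc n′ → flagH (Λ0 (suc n′)) u ≡ sumℤ (map (λ v → + expandCoeff v u) (cdIndexΛ0 n′))
flagH-Λ0 n′ u e = begin
  fToH (λ w → + flagF (Λ0 (suc n′)) w) u                      ≡⟨ fToH-congOnLength u (λ w p → cong +_ (sym (fExpand-cdIndexΛ0 n′ w (trans p e)))) ⟩
  fToH (λ w → + fExpand (cdIndexΛ0 n′) w) u                    ≡⟨ fToH-fExpand (cdIndexΛ0 n′) u ⟩
  sumℤ (map (λ v → fToH (λ w → + fExpandCoeff v w) u) (cdIndexΛ0 n′)) ≡⟨ sumℤ-cong (λ v → sym (fToHIdentity v u)) (cdIndexΛ0 n′) ⟩
  sumℤ (map (λ v → + expandCoeff v u) (cdIndexΛ0 n′))           ∎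
  where open ≡-Reasoning

-- Uniqueness of the cd-index

SumIndicator : ℕ → Set
SumIndicator n = ∀ x → degCD x ≡ n → ∀ (h : List CD → ℤ) → sumℤ (map (λ v → + indicator v x *ℤ h v) (cdWords n)) ≡ h x

sumIndicator-0 : SumIndicator 0
sumIndicator-0 [] _ h = trans (ℤ.+-identityʳ _) (ℤ.*-identityˡ (h []))
sumIndicator-0 (c ∷ _) ()
sumIndicator-0 (d ∷ _) ()

sumIndicator-1 : SumIndicator 1
sumIndicator-1 (c ∷ []) _ h = trans (ℤ.+-identityʳ _) (ℤ.*-identityˡ (h (c ∷ [])))
sumIndicator-1 (c ∷ c ∷ _) ()
sumIndicator-1 (c ∷ d ∷ _) ()
sumIndicator-1 (d ∷ _) ()

sum-cdWords-split : ∀ k (F : List CD → ℤ) → sumℤ (map F (cdWords (2 + k))) ≡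
  sumℤ (map (λ v → F (c ∷ v)) (cdWords (suc k))) +ℤ sumℤ (map (λ v → F (d ∷ v)) (cdWords k))
sum-cdWords-split k F =
  trans (sumℤ-++ F (map (c ∷_) (cdWords (suc k))) (map (d ∷_) (cdWords k)))
        (cong₂ _+ℤ_ (sumℤ-map-∘ F (c ∷_) (cdWords (suc k))) (sumℤ-map-∘ F (d ∷_) (cdWords k)))

sumIndicator-step : ∀ k → SumIndicator k → SumIndicator (suc k) → SumIndicator (2 + k)
sumIndicator-step k sumₖ sumₖ₊₁ (c ∷ x) deg h =
  trans (sum-cdWords-split k (λ v → + indicator v (c ∷ x) *ℤ h v))
        (trans (cong₂ _+ℤ_ (sumₖ₊₁ x (suc-injective deg) (λ v → h (c ∷ v))) (sumℤ-zero (λ _ → refl) (cdWords k)))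
               (ℤ.+-identityʳ _))
sumIndicator-step k sumₖ sumₖ₊₁ (d ∷ x) deg h =
  trans (sum-cdWords-split k (λ v → + indicator v (d ∷ x) *ℤ h v))
        (trans (cong₂ _+ℤ_ (sumℤ-zero (λ _ → refl) (cdWords (suc k))) (sumₖ x (suc-injective (suc-injective deg)) (λ v → h (d ∷ v))))
               (ℤ.+-identityˡ _))

sum-indicator-cdWords : ∀ n → SumIndicator n × SumIndicator (suc n)
sum-indicator-cdWords zero = sumIndicator-0 , sumIndicator-1
sum-indicator-cdWords (suc k) with sum-indicator-cdWords k
... | sumₖ , sumₖ₊₁ = sumₖ₊₁ , sumIndicator-step k sumₖ sumₖ₊₁

sum-multiplicity-cdWords : ∀ n vs (h : List CD → ℤ) → All (λ v → degCD v ≡ n) vs →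
  sumℤ (map (λ v → + multiplicity v vs *ℤ h v) (cdWords n)) ≡ sumℤ (map h vs)
sum-multiplicity-cdWords n [] h _ = sumℤ-zero (λ _ → refl) (cdWords n)
sum-multiplicity-cdWords n (y ∷ vs) h (deg-y ∷ deg-vs) = begin
  sumℤ (map (λ v → + (indicator v y + multiplicity v vs) *ℤ h v) (cdWords n))
    ≡⟨ sumℤ-cong (λ v → trans (cong (_*ℤ h v) (ℤ.pos-+ (indicator v y) (multiplicity v vs)))
                              (ℤ.*-distribʳ-+ (h v) (+ indicator v y) (+ multiplicity v vs))) (cdWords n) ⟩
  sumℤ (map (λ v → + indicator v y *ℤ h v +ℤ + multiplicity v vs *ℤ h v) (cdWords n))
    ≡⟨ sumℤ-+ (λ v → + indicator v y *ℤ h v) (λ v → + multiplicity v vs *ℤ h v) (cdWords n) ⟩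
  sumℤ (map (λ v → + indicator v y *ℤ h v) (cdWords n)) +ℤ sumℤ (map (λ v → + multiplicity v vs *ℤ h v) (cdWords n))
    ≡⟨ cong₂ _+ℤ_ (proj₁ (sum-indicator-cdWords n) y deg-y h) (sum-multiplicity-cdWords n vs h deg-vs) ⟩
  h y +ℤ sumℤ (map h vs) ∎
  where open ≡-Reasoning

ExpansionsIndependent : ℕ → Set
ExpansionsIndependent n = ∀ (Δ : List CD → ℤ) →
  (∀ u → length u ≡ n → sumℤ (map (λ v → Δ v *ℤ + expandCoeff v u) (cdWords n)) ≡ 0ℤ) →
  ∀ v → degCD v ≡ n → Δ v ≡ 0ℤ

expansionsIndependent-0 : ExpansionsIndependent 0
expansionsIndependent-0 Δ h [] _ = trans (sym (trans (ℤ.+-identityʳ _) (ℤ.*-identityʳ (Δ [])))) (h [] refl)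
expansionsIndependent-0 Δ h (c ∷ _) ()
expansionsIndependent-0 Δ h (d ∷ _) ()

expansionsIndependent-1 : ExpansionsIndependent 1
expansionsIndependent-1 Δ h (c ∷ []) _ = trans (sym (trans (ℤ.+-identityʳ _) (ℤ.*-identityʳ (Δ (c ∷ []))))) (h (a ∷ []) refl)
expansionsIndependent-1 Δ h (c ∷ c ∷ _) ()
expansionsIndependent-1 Δ h (c ∷ d ∷ _) ()
expansionsIndependent-1 Δ h (d ∷ _) ()

-- The words ab·u and bb·u isolate the monomials starting with d; then a·u isolates those starting with c.
expansionsIndependent-step : ∀ k → ExpansionsIndependent k → ExpansionsIndependent (suc k) → ExpansionsIndependent (2 + k)
expansionsIndependent-step k indepₖ indepₖ₊₁ Δ h = vanishes
  where
  S : List AB → ℤ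
  S u = sumℤ (map (λ v → Δ v *ℤ + expandCoeff v u) (cdWords (2 + k)))
  Sc : List AB → ℤ
  Sc u = sumℤ (map (λ v → Δ (c ∷ v) *ℤ + expandCoeff v u) (cdWords (suc k)))
  Sd : List AB → ℤ
  Sd u = sumℤ (map (λ v → Δ (d ∷ v) *ℤ + expandCoeff v u) (cdWords k))
  Sd′ : List AB → ℤ
  Sd′ u = sumℤ (map (λ v → Δ (d ∷ v) *ℤ + expandCoeff (d ∷ v) u) (cdWords k))
  split : ∀ x u → S (x ∷ u) ≡ Sc u +ℤ Sd′ (x ∷ u)
  split x u = sum-cdWords-split k (λ v → Δ v *ℤ + expandCoeff v (x ∷ u))
  Sd-vanishes : ∀ u → length u ≡ k → Sd u ≡ 0ℤ
  Sd-vanishes u e = begin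
    Sd u                                          ≡⟨ difference (Sc (b ∷ u)) (Sd u) ⟩
    (Sc (b ∷ u) +ℤ Sd u) +ℤ -ℤ (Sc (b ∷ u) +ℤ 0ℤ) ≡⟨ cong₂ (λ x y → x +ℤ -ℤ y) (trans (sym (split a (b ∷ u))) (h (a ∷ b ∷ u) (cong suc (cong suc e))))
                                                        (trans (cong (Sc (b ∷ u) +ℤ_) (sym (sumℤ-zero (λ v → ℤ.*-zeroʳ (Δ (d ∷ v))) (cdWords k))))
                                                               (trans (sym (split b (b ∷ u))) (h (b ∷ b ∷ u) (cong suc (cong suc e))))) ⟩
    0ℤ +ℤ -ℤ 0ℤ                                   ≡⟨⟩
    0ℤ                                            ∎
    where
    open ≡-Reasoning
    difference : ∀ p q → q ≡ (p +ℤ q) +ℤ -ℤ (p +ℤ 0ℤ)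
    difference = ℤ-Solver.solve-∀
  Δd-vanishes : ∀ v → degCD v ≡ k → Δ (d ∷ v) ≡ 0ℤ
  Δd-vanishes = indepₖ (λ v → Δ (d ∷ v)) Sd-vanishes
  Sc-vanishes : ∀ u → length u ≡ suc k → Sc u ≡ 0ℤ
  Sc-vanishes u e = begin
    Sc u                 ≡⟨ sym (ℤ.+-identityʳ _) ⟩
    Sc u +ℤ 0ℤ           ≡⟨ cong (Sc u +ℤ_) (sym (trans (sumℤ-congOn {g = λ _ → 0ℤ} (λ v deg → cong (_*ℤ + expandCoeff (d ∷ v) (a ∷ u)) (Δd-vanishes v deg))
                                                                          (proj₁ (cdWords-degree k)))
                                                          (sumℤ-zero (λ _ → refl) (cdWords k)))) ⟩
    Sc u +ℤ Sd′ (a ∷ u)  ≡⟨ sym (split a u) ⟩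
    S (a ∷ u)            ≡⟨ h (a ∷ u) (cong suc e) ⟩
    0ℤ                   ∎
    where open ≡-Reasoning
  vanishes : ∀ v → degCD v ≡ 2 + k → Δ v ≡ 0ℤ
  vanishes (c ∷ v) deg = indepₖ₊₁ (λ v → Δ (c ∷ v)) Sc-vanishes v (suc-injective deg)
  vanishes (d ∷ v) deg = Δd-vanishes v (suc-injective (suc-injective deg))

expansions-independent : ∀ n → ExpansionsIndependent n × ExpansionsIndependent (suc n)
expansions-independent zero = expansionsIndependent-0 , expansionsIndependent-1
expansions-independent (suc k) with expansions-independent k
... | indepₖ , indepₖ₊₁ = indepₖ₊₁ , expansionsIndependent-step k indepₖ indepₖ₊₁

cdIndex-determined : ∀ n (Φ Ψ : List CD → ℤ) →
  (∀ u → length u ≡ n → substCoeff Φ u ≡ substCoeff Ψ u) → ∀ v → degCD v ≡ n → Φ v ≡ Ψ v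
cdIndex-determined n Φ Ψ sameExpansion v deg =
  ℤ.i-j≡0⇒i≡j (Φ v) (Ψ v) (proj₁ (expansions-independent n) (λ v → Φ v -ℤ Ψ v) differenceVanishes v deg)
  where
  differenceVanishes : ∀ u → length u ≡ n → sumℤ (map (λ v → (Φ v -ℤ Ψ v) *ℤ + expandCoeff v u) (cdWords n)) ≡ 0ℤ
  differenceVanishes u refl = begin
    sumℤ (map (λ v → (Φ v -ℤ Ψ v) *ℤ + expandCoeff v u) (cdWords n))
      ≡⟨ sumℤ-cong (λ v → trans (ℤ.*-distribʳ-+ (+ expandCoeff v u) (Φ v) (-ℤ Ψ v))
                                (cong (Φ v *ℤ + expandCoeff v u +ℤ_) (sym (ℤ.neg-distribˡ-* (Ψ v) (+ expandCoeff v u))))) (cdWords n) ⟩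
    sumℤ (map (λ v → Φ v *ℤ + expandCoeff v u +ℤ -ℤ (Ψ v *ℤ + expandCoeff v u)) (cdWords n))
      ≡⟨ sumℤ-+ (λ v → Φ v *ℤ + expandCoeff v u) (λ v → -ℤ (Ψ v *ℤ + expandCoeff v u)) (cdWords n) ⟩
    substCoeff Φ u +ℤ sumℤ (map (λ v → -ℤ (Ψ v *ℤ + expandCoeff v u)) (cdWords n))
      ≡⟨ cong₂ _+ℤ_ (sameExpansion u refl) (sumℤ-neg (λ v → Ψ v *ℤ + expandCoeff v u) (cdWords n)) ⟩
    substCoeff Ψ u -ℤ substCoeff Ψ u
      ≡⟨ ℤ.+-inverseʳ (substCoeff Ψ u) ⟩
    0ℤ ∎
    where open ≡-Reasoning

cdIndexΛ0-coefficient : ∀ n′ (Φ : List CD → ℤ) → IsCheckPhi0 (suc n′) Φ → ∀ w → degCD w ≡ n′ →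
  Φ (w ++ c ∷ []) ≡ + multiplicity w (cdIndexBoolean n′)
cdIndexΛ0-coefficient n′ Φ (_ , isCDIndex) w deg =
  trans (cdIndex-determined (suc n′) Φ (λ v → + multiplicity v (cdIndexΛ0 n′)) sameExpansion (w ++ c ∷ [])
                            (trans (degCD-∷ʳ w c) (cong suc deg)))
        (cong +_ (multiplicity-map-∷ʳ c w (cdIndexBoolean n′)))
  where
  sameExpansion : ∀ u → length u ≡ suc n′ → substCoeff Φ u ≡ substCoeff (λ v → + multiplicity v (cdIndexΛ0 n′)) u
  sameExpansion u e = begin
    substCoeff Φ u          ≡⟨ isCDIndex u e ⟩
    flagH (Λ0 (suc n′)) u   ≡⟨ flagH-Λ0 n′ u e ⟩
    sumℤ (map (λ v → + expandCoeff v u) (cdIndexΛ0 n′))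
      ≡⟨ sym (sum-multiplicity-cdWords (length u) (cdIndexΛ0 n′) (λ v → + expandCoeff v u)
                (subst (λ n → All (λ v → degCD v ≡ n) (cdIndexΛ0 n′)) (sym e) (cdIndexΛ0-degree n′))) ⟩
    substCoeff (λ v → + multiplicity v (cdIndexΛ0 n′)) u ∎
    where open ≡-Reasoning

proposition4p5 : (n : ℕ) → 4 ≤ n → (w : List CD) → (m : ℕ) →
    degCD w ≡ n ∸ 1 → countD w ≡ m →
    (∃[ Ps ] (Unique Ps × 2 ^ m ≤ length Ps ×
              All (λ π → IsPermutationOf n π × IsAndre π × W π ≡ w ++ (c ∷ []) × at π n ≡ n) Ps))
    × (∀ (Φ : List CD → ℤ) → IsCheckPhi0 n Φ → + (2 ^ m) ≤ℤ Φ (w ++ (c ∷ [])))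
proposition4p5 (suc (suc (suc (suc k)))) (s≤s (s≤s (s≤s (s≤s z≤n)))) w .(countD w) deg refl =
  andrePermutations-endingInMax (3 + k) w deg w≢d ,
  λ Φ isCheckPhi0 → subst (+ (2 ^ countD w) ≤ℤ_) (sym (cdIndexΛ0-coefficient (3 + k) Φ isCheckPhi0 w deg))
                          (+≤+ (cdIndexBoolean-lowerBound k w deg))
  where
  w≢d : w ≢ d ∷ []
  w≢d refl = 0≢1+n (suc-injective (suc-injective deg))
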